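{- For any $k\ge2$, $0\le a\le k-1$ and $1\le r\le k-1$, the lower-triangular array $F^{k,a,r}$ whose $(n,m)$-entry is $F^{k,a,r}_{n,m}$ ($0\le m\le n$) is a proper Riordan array with $A$-sequence and $Z$-sequence $$A(t)=(1+t)^k,\qquad Z(t)=\frac{(1+t)^k-(1+t)^{k-a-1}}{t}-(1+t)^{k-r-1}.$$
   Context: For $k\ge2$, $a\ge0$ and $1\le r\le k-1$, a generalized $(k,r)$-Fine path of depth $a$, semilength $n$ and semiheight $m$ is an integer lattice path from $(0,0)$ to $(kn,km)$ using steps $U=(1,1)$ and $D_{k-1}=(1,1-k)$ that stays weakly above the line $y=-a$ and contains no subpath of the form $U^rD_{k-1}$ ($r$ consecutive $U$ steps followed by a $D_{k-1}$ step) ending at height $0$. $F^{k,a,r}_{n,m}$ is the number of such paths. A proper Riordan array $\mathcal R(d(t),h(t))$, for formal power series with $d(0)\ne0$, $h(0)=0$, $h'(0)\neq 0$, is the lower-triangular array with $(i,j)$-entry $d_{i,j}=[t^i]\,d(t)h(t)^j$. Power series $A(t)=\sum a_rt^r$ and $Z(t)=\sum z_rt^r$ are its $A$-sequence and $Z$-sequence if for all $i\ge1$: $d_{i,j}=\sum_{s\ge0}a_s d_{i-1,j-1+s}$ for $j\ge1$ and $d_{i,0}=\sum_{s\ge0} z_s d_{i-1,s}$. -}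

module Defs where

open import Data.Bool using (Bool; true; false; _∧_; not; if_then_else_)
open import Data.Nat as ℕ using (ℕ; zero; suc; _∸_; _≤ᵇ_)
open import Data.Integer as ℤ using (ℤ; +_; -_; 0ℤ; 1ℤ)
open import Data.List using (List; []; _∷_; length; filter; map; concatMap; upTo; foldr)
open import Relation.Nullary.Decidable using (⌊_⌋)
open import Relation.Unary using (Decidable)
open import Data.Bool using (T; T?)
open import Data.Product using (Σ; _×_)
open import Relation.Binary.PropositionalEquality using (_≡_; _≢_)

-- Lattice paths with steps U = (1,1) and D_{k-1} = (1,1-k)

data Step : Set where
  U D : Step

δ : ℕ → Step → ℤ
δ k U = 1ℤ
δ k D = 1ℤ ℤ.- (+ k)

allPaths : ℕ → List (List Step)
allPaths zero    = [] ∷ []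
allPaths (suc N) = concatMap (λ p → (U ∷ p) ∷ (D ∷ p) ∷ []) (allPaths N)

endHeight : ℕ → ℤ → List Step → ℤ
endHeight k h []       = h
endHeight k h (s ∷ ss) = endHeight k (h ℤ.+ δ k s) ss

staysAbove : ℕ → ℕ → ℤ → List Step → Bool
staysAbove k a h []       = true
staysAbove k a h (s ∷ ss) =
  (ℤ.- (+ a) ℤ.≤ᵇ (h ℤ.+ δ k s)) ∧ staysAbove k a (h ℤ.+ δ k s) ss

startsWithURD : ℕ → List Step → Bool
startsWithURD zero    (D ∷ ss) = true
startsWithURD zero    _        = false
startsWithURD (suc r) (U ∷ ss) = startsWithURD r ss
startsWithURD (suc r) _        = false

-- the path (started at height h) contains no consecutive subpath U^r D_{k-1}
-- ending at height 0.  A subpath U^r D starting at height h ends at height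
-- h + r + 1 - k.
noBadPattern : ℕ → ℕ → ℤ → List Step → Bool
noBadPattern k r h []       = true
noBadPattern k r h (s ∷ ss) =
  not (startsWithURD r (s ∷ ss) ∧ ⌊ (h ℤ.+ (+ r) ℤ.+ 1ℤ ℤ.- (+ k)) ℤ.≟ 0ℤ ⌋)
  ∧ noBadPattern k r (h ℤ.+ δ k s) ss

isFinePath : ℕ → ℕ → ℕ → ℕ → List Step → Bool
isFinePath k a r m p =
  ⌊ endHeight k 0ℤ p ℤ.≟ + (k ℕ.* m) ⌋ ∧ staysAbove k a 0ℤ p ∧ noBadPattern k r 0ℤ p

F : ℕ → ℕ → ℕ → ℕ → ℕ → ℕ
F k a r n m = length (filter (λ p → T? (isFinePath k a r m p)) (allPaths (k ℕ.* n)))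

Farr : ℕ → ℕ → ℕ → ℕ → ℕ → ℤ
Farr k a r n m = if m ≤ᵇ n then + (F k a r n m) else 0ℤ

Series : Set
Series = ℕ → ℤ

sumTo : ℕ → (ℕ → ℤ) → ℤ
sumTo n f = foldr (λ i acc → f i ℤ.+ acc) 0ℤ (upTo n)

_⊛_ : Series → Series → Series
(f ⊛ g) n = sumTo (suc n) (λ i → f i ℤ.* g (n ∸ i))

oneS : Series
oneS zero    = 1ℤ
oneS (suc _) = 0ℤ

_^S_ : Series → ℕ → Series
f ^S zero  = oneS
f ^S suc j = f ⊛ (f ^S j)

_-S_ : Series → Series → Series
(f -S g) n = f n ℤ.- g n

-- division by t (of a series whose constant term vanishes)
divT : Series → Series
divT f n = f (suc n)

onePlusT : Series
onePlusT zero          = 1ℤ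
onePlusT (suc zero)    = 1ℤ
onePlusT (suc (suc _)) = 0ℤ

Aseq : ℕ → Series
Aseq k = onePlusT ^S k

Zseq : ℕ → ℕ → ℕ → Series
Zseq k a r = divT ((onePlusT ^S k) -S (onePlusT ^S (k ∸ a ∸ 1))) -S (onePlusT ^S (k ∸ r ∸ 1))

IsRiordanOf : (ℕ → ℕ → ℤ) → Series → Series → Set
IsRiordanOf M d h = ∀ i j → M i j ≡ (d ⊛ (h ^S j)) i

IsProperRiordan : (ℕ → ℕ → ℤ) → Set
IsProperRiordan M = Σ Series λ d → Σ Series λ h →
  (d 0 ≢ 0ℤ) × (h 0 ≡ 0ℤ) × (h 1 ≢ 0ℤ) × IsRiordanOf M d h

-- A-sequence: for i ≥ 1, j ≥ 1, M i j = Σ_{s≥0} A_s M (i-1) (j-1+s).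
-- For a lower-triangular M (as every Riordan array is) the terms with s ≥ i
-- vanish (j-1+s > i-1), so the sum is taken over s < i.
HasASeq : (ℕ → ℕ → ℤ) → Series → Set
HasASeq M A = ∀ i j → M (suc i) (suc j) ≡ sumTo (suc i) (λ s → A s ℤ.* M i (j ℕ.+ s))

-- Z-sequence: for i ≥ 1, M i 0 = Σ_{s≥0} Z_s M (i-1) s  (terms with s ≥ i vanish).
HasZSeq : (ℕ → ℕ → ℤ) → Series → Set
HasZSeq M Z = ∀ i → M (suc i) 0 ≡ sumTo (suc i) (λ s → Z s ℤ.* M i s)

-- Cut a fine path of semilength n + 1 after its first kn steps.  Each step changes the
-- height by 1 modulo k and the path stays above -a > -k, so the cut lies at a height ks
-- with 0 ≤ s ≤ n; a forbidden factor U^r D ending at height 0 could only straddle a cut at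
-- a height in [1, k - 1].  Hence F(n+1, m) = Σ_s F(n, s) G(m, s), where G(m, s) counts the
-- admissible blocks of k steps from height ks to height km.  For m ≥ 1 such a block stays at
-- positive height, so G(m, s) = C(k, s - m + 1): the A-sequence is (1 + t)^k.  For m = 0 a
-- block with s + 1 down steps dips below -a iff it ends with U^(a+1), and contains a
-- forbidden factor iff it ends with U^r D (only its last step can reach height 0); these
-- exclude each other, leaving C(k, s+1) - C(k-a-1, s+1) - C(k-r-1, s) = Z_s.  Finally, an
-- array with first row 1, 0, 0, … and an A-sequence A is the Riordan array R(d, h) with d
-- its first column and h the solution of h = t A(h).

module Submission where

open import Defs
open import Data.Nat using (ℕ; _≤_)
open import Data.Nat as ℕ using (zero; suc; _∸_; _<_; z≤n; s≤s)
import Data.Nat.Properties as ℕₚ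
open import Data.Integer as ℤ using (ℤ; +_; -_; 0ℤ; 1ℤ; _+_; _*_; _-_; _⊖_; +≤+)
import Data.Integer.Properties as ℤₚ
open import Algebra.Bundles using (AbelianGroup)
open import Algebra.Properties.Group (AbelianGroup.group ℤₚ.+-0-abelianGroup) using ()
  renaming (∙-cancelʳ to +-cancelʳ)
open import Data.Integer.Tactic.RingSolver using (solve-∀)
open import Data.List using (List; []; _∷_; _++_; length; filter; concatMap; drop; foldr; applyUpTo)
import Data.List.Properties as Listₚ
open import Data.Bool using (Bool; true; false; _∧_; not; T; T?)
import Data.Bool.Properties as BP
open import Data.Product using (Σ; _×_; _,_)
open import Data.Empty using (⊥; ⊥-elim)
open import Data.Unit using (⊤; tt)
open import Function using (_∘_)
open import Function.Bundles using (Equivalence)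
open import Relation.Nullary using (¬_; Dec; yes; no)
open import Relation.Nullary.Decidable using (⌊_⌋; toWitness; fromWitness; fromWitnessFalse)
open import Relation.Binary.PropositionalEquality

∑ : ℕ → (ℕ → ℤ) → ℤ
∑ zero    f = 0ℤ
∑ (suc n) f = f 0 + ∑ n (f ∘ suc)

private
  foldr-applyUpTo : ∀ n (g : ℕ → ℕ) (f : ℕ → ℤ) →
    foldr (λ i acc → f i + acc) 0ℤ (applyUpTo g n) ≡ ∑ n (f ∘ g)
  foldr-applyUpTo zero    g f = refl
  foldr-applyUpTo (suc n) g f = cong (_+_ (f (g 0))) (foldr-applyUpTo n (g ∘ suc) f)

sumTo≡∑ : ∀ n f → sumTo n f ≡ ∑ n f
sumTo≡∑ n f = foldr-applyUpTo n (λ i → i) f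

∑-cong : ∀ n {f g : ℕ → ℤ} → (∀ i → i < n → f i ≡ g i) → ∑ n f ≡ ∑ n g
∑-cong zero    f≡g = refl
∑-cong (suc n) f≡g = cong₂ _+_ (f≡g 0 (s≤s z≤n)) (∑-cong n (λ i i<n → f≡g (suc i) (s≤s i<n)))

∑-zero : ∀ n {f : ℕ → ℤ} → (∀ i → i < n → f i ≡ 0ℤ) → ∑ n f ≡ 0ℤ
∑-zero zero    f≡0 = refl
∑-zero (suc n) f≡0 = cong₂ _+_ (f≡0 0 (s≤s z≤n)) (∑-zero n (λ i i<n → f≡0 (suc i) (s≤s i<n)))

∑-+ : ∀ n (f g : ℕ → ℤ) → ∑ n (λ i → f i + g i) ≡ ∑ n f + ∑ n g
∑-+ zero    f g = refl
∑-+ (suc n) f g = trans (cong (_+_ (f 0 + g 0)) (∑-+ n (f ∘ suc) (g ∘ suc)))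
                       (interchange (f 0) (g 0) _ _)
  where
  interchange : ∀ a b c d → (a + b) + (c + d) ≡ (a + c) + (b + d)
  interchange = solve-∀

∑-*ˡ : ∀ n c (f : ℕ → ℤ) → ∑ n (λ i → c * f i) ≡ c * ∑ n f
∑-*ˡ zero    c f = sym (ℤₚ.*-zeroʳ c)
∑-*ˡ (suc n) c f = trans (cong (_+_ (c * f 0)) (∑-*ˡ n c (f ∘ suc))) (sym (ℤₚ.*-distribˡ-+ c (f 0) _))

∑-split : ∀ m n (f : ℕ → ℤ) → ∑ (m ℕ.+ n) f ≡ ∑ m f + ∑ n (λ i → f (m ℕ.+ i))
∑-split zero    n f = sym (ℤₚ.+-identityˡ _)
∑-split (suc m) n f = trans (cong (_+_ (f 0)) (∑-split m n (f ∘ suc))) (sym (ℤₚ.+-assoc (f 0) _ _))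

∑-comm : ∀ m n (f : ℕ → ℕ → ℤ) → ∑ m (λ i → ∑ n (f i)) ≡ ∑ n (λ j → ∑ m (λ i → f i j))
∑-comm zero    n f = sym (∑-zero n (λ _ _ → refl))
∑-comm (suc m) n f = trans (cong (_+_ (∑ n (f 0))) (∑-comm m n (f ∘ suc)))
                           (sym (∑-+ n (f 0) (λ j → ∑ m (λ i → f (suc i) j))))

∑-single : ∀ n j {f : ℕ → ℤ} → j < n → (∀ i → i < n → i ≢ j → f i ≡ 0ℤ) → ∑ n f ≡ f j
∑-single (suc n) zero    {f} _ f≡0 =
  trans (cong (_+_ (f 0)) (∑-zero n (λ i i<n → f≡0 (suc i) (s≤s i<n) (λ ())))) (ℤₚ.+-identityʳ _)
∑-single (suc n) (suc j) {f} (s≤s j<n) f≡0 =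
  trans (cong (_+ ∑ n (f ∘ suc)) (f≡0 0 (s≤s z≤n) (λ ())))
        (trans (ℤₚ.+-identityˡ _)
               (∑-single n j j<n (λ i i<n i≢j → f≡0 (suc i) (s≤s i<n) (i≢j ∘ ℕₚ.suc-injective))))

∑-extend : ∀ n m {f : ℕ → ℤ} → (∀ i → n ≤ i → f i ≡ 0ℤ) → ∑ (n ℕ.+ m) f ≡ ∑ n f
∑-extend n m {f} f≡0 =
  trans (∑-split n m f)
        (trans (cong (_+_ (∑ n f)) (∑-zero m (λ i _ → f≡0 (n ℕ.+ i) (ℕₚ.m≤m+n n i)))) (ℤₚ.+-identityʳ _))

∑-shift : ∀ n j {f : ℕ → ℤ} → (∀ i → i < j → f i ≡ 0ℤ) → (∀ i → n ≤ i → f i ≡ 0ℤ) →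
  ∑ n f ≡ ∑ n (λ i → f (j ℕ.+ i))
∑-shift n j {f} below above = begin
  ∑ n f                ≡⟨ ∑-extend n j above ⟨
  ∑ (n ℕ.+ j) f        ≡⟨ cong (λ x → ∑ x f) (ℕₚ.+-comm n j) ⟩
  ∑ (j ℕ.+ n) f        ≡⟨ ∑-split j n f ⟩
  ∑ j f + ∑ n shifted  ≡⟨ cong (_+ ∑ n shifted) (∑-zero j below) ⟩
  0ℤ + ∑ n shifted     ≡⟨ ℤₚ.+-identityˡ _ ⟩
  ∑ n shifted          ∎
  where
  open ≡-Reasoning
  shifted : ℕ → ℤ
  shifted = λ i → f (j ℕ.+ i)

-- `associated A` is the Riordan array R(1, h) whose A-sequence is A.

module _ (A : Series) where

  associated : ℕ → ℕ → ℤ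
  associated zero    zero    = 1ℤ
  associated zero    (suc j) = 0ℤ
  associated (suc i) zero    = 0ℤ
  associated (suc i) (suc j) = ∑ (suc i) (λ s → A s * associated i (j ℕ.+ s))

  hOfASeq : Series
  hOfASeq i = associated i 1

  associated-upper : ∀ {i j} → i < j → associated i j ≡ 0ℤ
  associated-upper {zero}  {suc j} _         = refl
  associated-upper {suc i} {suc j} (s≤s i<j) = ∑-zero (suc i) (λ s _ →
    trans (cong (A s *_) (associated-upper (ℕₚ.≤-trans i<j (ℕₚ.m≤m+n j s)))) (ℤₚ.*-zeroʳ (A s)))

  ∑-*-associated-col₀ : ∀ n (f : ℕ → ℤ) → ∑ (suc n) (λ l → f l * associated (n ∸ l) 0) ≡ f n
  ∑-*-associated-col₀ n f =
    trans (∑-single (suc n) n ℕₚ.≤-refl off-diagonal)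
          (trans (cong (λ x → f n * associated x 0) (ℕₚ.n∸n≡0 n)) (ℤₚ.*-identityʳ (f n)))
    where
    off-diagonal : ∀ l → l < suc n → l ≢ n → f l * associated (n ∸ l) 0 ≡ 0ℤ
    off-diagonal l (s≤s l≤n) l≢n with n ∸ l in eq
    ... | zero  = ⊥-elim (l≢n (ℕₚ.≤-antisym l≤n (ℕₚ.m∸n≡0⇒m≤n eq)))
    ... | suc _ = ℤₚ.*-zeroʳ (f l)

  -- The A-recurrence of row i - l + 1, with the vanishing terms s > i - l added back.
  associated-rec : ∀ {i l} j → l ≤ i →
    ∑ (suc i) (λ s → A s * associated (i ∸ l) (j ℕ.+ s)) ≡ associated (suc i ∸ l) (suc j)
  associated-rec {i} {l} j l≤i = begin
    ∑ (suc i) term                ≡⟨ cong (λ x → ∑ x term) (cong suc (ℕₚ.m∸n+n≡m l≤i)) ⟨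
    ∑ (suc (i ∸ l) ℕ.+ l) term    ≡⟨ ∑-extend (suc (i ∸ l)) l above-diagonal ⟩
    ∑ (suc (i ∸ l)) term          ≡⟨ cong (λ x → associated x (suc j)) (ℕₚ.+-∸-assoc 1 l≤i) ⟨
    associated (suc i ∸ l) (suc j) ∎
    where
    open ≡-Reasoning
    term : ℕ → ℤ
    term s = A s * associated (i ∸ l) (j ℕ.+ s)
    above-diagonal : ∀ s → suc (i ∸ l) ≤ s → term s ≡ 0ℤ
    above-diagonal s i∸l<s =
      trans (cong (A s *_) (associated-upper (ℕₚ.≤-trans i∸l<s (ℕₚ.m≤n+m s j)))) (ℤₚ.*-zeroʳ (A s))

  -- The A-recurrence is linear, and `associated` is its solution with first column δ_{i,0}.
  ASeq⇒∑-associated : (M : ℕ → ℕ → ℤ) → (∀ j → M 0 (suc j) ≡ 0ℤ) → HasASeq M A →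
    ∀ i j → M i j ≡ ∑ (suc i) (λ l → M l 0 * associated (i ∸ l) j)
  ASeq⇒∑-associated M row₀ rec zero    zero    = sym (trans (ℤₚ.+-identityʳ _) (ℤₚ.*-identityʳ (M 0 0)))
  ASeq⇒∑-associated M row₀ rec zero    (suc j) = trans (row₀ j) (sym (trans (ℤₚ.+-identityʳ _) (ℤₚ.*-zeroʳ (M 0 0))))
  ASeq⇒∑-associated M row₀ rec (suc i) zero    = sym (∑-*-associated-col₀ (suc i) (λ l → M l 0))
  ASeq⇒∑-associated M row₀ rec (suc i) (suc j) = begin
    M (suc i) (suc j)
      ≡⟨ trans (rec i j) (sumTo≡∑ (suc i) (λ s → A s * M i (j ℕ.+ s))) ⟩
    ∑ (suc i) (λ s → A s * M i (j ℕ.+ s))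
      ≡⟨ ∑-cong (suc i) (λ s _ → cong (A s *_) (ASeq⇒∑-associated M row₀ rec i (j ℕ.+ s))) ⟩
    ∑ (suc i) (λ s → A s * ∑ (suc i) (λ l → M l 0 * associated (i ∸ l) (j ℕ.+ s)))
      ≡⟨ ∑-cong (suc i) (λ s _ → sym (∑-*ˡ (suc i) (A s) (λ l → M l 0 * associated (i ∸ l) (j ℕ.+ s)))) ⟩
    ∑ (suc i) (λ s → ∑ (suc i) (λ l → A s * (M l 0 * associated (i ∸ l) (j ℕ.+ s))))
      ≡⟨ ∑-comm (suc i) (suc i) (λ s l → A s * (M l 0 * associated (i ∸ l) (j ℕ.+ s))) ⟩
    ∑ (suc i) (λ l → ∑ (suc i) (λ s → A s * (M l 0 * associated (i ∸ l) (j ℕ.+ s))))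
      ≡⟨ ∑-cong (suc i) (λ l _ → factor-out l) ⟩
    ∑ (suc i) (λ l → M l 0 * ∑ (suc i) (λ s → A s * associated (i ∸ l) (j ℕ.+ s)))
      ≡⟨ ∑-cong (suc i) (λ l l<1+i → cong (M l 0 *_) (associated-rec j (ℕₚ.≤-pred l<1+i))) ⟩
    ∑ (suc i) term
      ≡⟨ ∑-extend (suc i) 1 beyond-row ⟨
    ∑ (suc i ℕ.+ 1) term
      ≡⟨ cong (λ x → ∑ x term) (ℕₚ.+-comm (suc i) 1) ⟩
    ∑ (suc (suc i)) term
      ∎
    where
    open ≡-Reasoning
    term : ℕ → ℤ
    term l = M l 0 * associated (suc i ∸ l) (suc j)
    swap : ∀ a b c → a * (b * c) ≡ b * (a * c)
    swap = solve-∀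
    factor-out : ∀ l → ∑ (suc i) (λ s → A s * (M l 0 * associated (i ∸ l) (j ℕ.+ s))) ≡
                       M l 0 * ∑ (suc i) (λ s → A s * associated (i ∸ l) (j ℕ.+ s))
    factor-out l = trans (∑-cong (suc i) (λ s _ → swap (A s) (M l 0) (associated (i ∸ l) (j ℕ.+ s))))
                         (∑-*ˡ (suc i) (M l 0) (λ s → A s * associated (i ∸ l) (j ℕ.+ s)))
    beyond-row : ∀ l → suc i ≤ l → term l ≡ 0ℤ
    beyond-row l 1+i≤l =
      trans (cong (λ x → M l 0 * associated x (suc j)) (ℕₚ.m≤n⇒m∸n≡0 1+i≤l)) (ℤₚ.*-zeroʳ (M l 0))

  associated≡h^ : ∀ j i → associated i j ≡ (hOfASeq ^S j) i
  associated≡h^ zero    zero    = refl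
  associated≡h^ zero    (suc i) = refl
  associated≡h^ (suc j) i = begin
    associated i (suc j)
      ≡⟨ ASeq⇒∑-associated (λ i j → associated i (suc j)) (λ _ → refl) shifted-rec i j ⟩
    ∑ (suc i) (λ l → hOfASeq l * associated (i ∸ l) j)
      ≡⟨ ∑-cong (suc i) (λ l _ → cong (hOfASeq l *_) (associated≡h^ j (i ∸ l))) ⟩
    ∑ (suc i) (λ l → hOfASeq l * (hOfASeq ^S j) (i ∸ l))
      ≡⟨ sumTo≡∑ (suc i) (λ l → hOfASeq l * (hOfASeq ^S j) (i ∸ l)) ⟨
    (hOfASeq ^S suc j) i
      ∎
    where
    open ≡-Reasoning
    shifted-rec : HasASeq (λ i j → associated i (suc j)) A
    shifted-rec i j = sym (sumTo≡∑ (suc i) (λ s → A s * associated i (suc j ℕ.+ s)))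

  ASeq⇒IsRiordanOf : (M : ℕ → ℕ → ℤ) → (∀ j → M 0 (suc j) ≡ 0ℤ) → HasASeq M A →
    IsRiordanOf M (λ i → M i 0) hOfASeq
  ASeq⇒IsRiordanOf M row₀ rec i j = begin
    M i j
      ≡⟨ ASeq⇒∑-associated M row₀ rec i j ⟩
    ∑ (suc i) (λ l → M l 0 * associated (i ∸ l) j)
      ≡⟨ ∑-cong (suc i) (λ l _ → cong (M l 0 *_) (associated≡h^ j (i ∸ l))) ⟩
    ∑ (suc i) (λ l → M l 0 * (hOfASeq ^S j) (i ∸ l))
      ≡⟨ sumTo≡∑ (suc i) (λ l → M l 0 * (hOfASeq ^S j) (i ∸ l)) ⟨
    ((λ l → M l 0) ⊛ (hOfASeq ^S j)) i
      ∎
    where open ≡-Reasoning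

  ASeq⇒IsProperRiordan : (M : ℕ → ℕ → ℤ) → M 0 0 ≢ 0ℤ → A 0 ≢ 0ℤ →
    (∀ j → M 0 (suc j) ≡ 0ℤ) → HasASeq M A → IsProperRiordan M
  ASeq⇒IsProperRiordan M M₀₀≢0 A₀≢0 row₀ rec =
    (λ i → M i 0) , hOfASeq , M₀₀≢0 , refl , A₀≢0 ∘ trans h₁≡A₀ , ASeq⇒IsRiordanOf M row₀ rec
    where
    h₁≡A₀ : A 0 ≡ hOfASeq 1
    h₁≡A₀ = sym (trans (ℤₚ.+-identityʳ _) (ℤₚ.*-identityʳ (A 0)))

𝟙[_] : Bool → ℤ
𝟙[ true ]  = 1ℤ
𝟙[ false ] = 0ℤ

𝟙-∧ : ∀ b c → 𝟙[ b ∧ c ] ≡ 𝟙[ b ] * 𝟙[ c ]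
𝟙-∧ true  c = sym (ℤₚ.*-identityˡ 𝟙[ c ])
𝟙-∧ false c = refl

≤ᵇ-true : ∀ {x y} → x ℤ.≤ y → (x ℤ.≤ᵇ y) ≡ true
≤ᵇ-true x≤y = Equivalence.to BP.T-≡ (ℤₚ.≤⇒≤ᵇ x≤y)

≤ᵇ-false : ∀ {x y} → ¬ (x ℤ.≤ y) → (x ℤ.≤ᵇ y) ≡ false
≤ᵇ-false {x} {y} x≰y with x ℤ.≤ᵇ y in eq
... | true  = ⊥-elim (x≰y (ℤₚ.≤ᵇ⇒≤ (Equivalence.from BP.T-≡ eq)))
... | false = refl

⌊⌋-true : ∀ {A : Set} (a? : Dec A) → A → ⌊ a? ⌋ ≡ true
⌊⌋-true a? a = Equivalence.to BP.T-≡ (fromWitness {a? = a?} a)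

⌊⌋-false : ∀ {A : Set} (a? : Dec A) → ¬ A → ⌊ a? ⌋ ≡ false
⌊⌋-false a? ¬a = Equivalence.to BP.T-not-≡ (fromWitnessFalse {a? = a?} ¬a)

⌊⌋-sound : ∀ {A : Set} (a? : Dec A) → ⌊ a? ⌋ ≡ true → A
⌊⌋-sound a? holds = toWitness {a? = a?} (Equivalence.from BP.T-≡ holds)

⌊⌋≡≡ᵇ : ∀ {A : Set} {m n} (a? : Dec A) → (A → m ≡ n) → (m ≡ n → A) → ⌊ a? ⌋ ≡ (m ℕ.≡ᵇ n)
⌊⌋≡≡ᵇ {m = m} {n} (yes a) to from = sym (Equivalence.to BP.T-≡ (ℕₚ.≡⇒≡ᵇ m n (to a)))
⌊⌋≡≡ᵇ {m = m} {n} (no ¬a) to from with m ℕ.≡ᵇ n in eq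
... | true  = ⊥-elim (¬a (from (ℕₚ.≡ᵇ⇒≡ m n (Equivalence.from BP.T-≡ eq))))
... | false = refl

x+L≡M⇒x≡M⊖L : ∀ x L M → x + + L ≡ + M → x ≡ M ⊖ L
x+L≡M⇒x≡M⊖L x L M eq = trans (+-cancelʳ (+ L) x (+ M - + L) (trans eq (cancel (+ M) (+ L)))) (ℤₚ.m-n≡m⊖n M L)
  where
  cancel : ∀ m l → m ≡ m - l + l
  cancel = solve-∀

-- k d + r = k + L with r, L < k forces d = 1.
k*d+r≡k+L⇒r≡L : ∀ k d {r L} → r < k → L < k → k ℕ.* d ℕ.+ r ≡ k ℕ.+ L → r ≡ L
k*d+r≡k+L⇒r≡L k zero          {r} {L} r<k L<k eq =
  ⊥-elim (ℕₚ.<⇒≱ r<k (subst (k ≤_) (trans (sym eq) (cong (ℕ._+ r) (ℕₚ.*-zeroʳ k))) (ℕₚ.m≤m+n k L)))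
k*d+r≡k+L⇒r≡L k (suc zero)    {r} {L} r<k L<k eq =
  ℕₚ.+-cancelˡ-≡ k r L (trans (cong (ℕ._+ r) (sym (ℕₚ.*-identityʳ k))) eq)
k*d+r≡k+L⇒r≡L k (suc (suc d)) {r} {L} r<k L<k eq = ⊥-elim (ℕₚ.<⇒≱ (ℕₚ.+-monoʳ-< k L<k) 2k≤k+L)
  where
  2k≤k+L : k ℕ.+ k ≤ k ℕ.+ L
  2k≤k+L = begin
    k ℕ.+ k                        ≤⟨ ℕₚ.+-monoʳ-≤ k (ℕₚ.m≤m+n k (k ℕ.* d)) ⟩
    k ℕ.+ (k ℕ.+ k ℕ.* d)          ≡⟨ cong (k ℕ.+_) (ℕₚ.*-suc k d) ⟨
    k ℕ.+ k ℕ.* suc d              ≡⟨ ℕₚ.*-suc k (suc d) ⟨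
    k ℕ.* suc (suc d)              ≤⟨ ℕₚ.m≤m+n _ r ⟩
    k ℕ.* suc (suc d) ℕ.+ r        ≡⟨ eq ⟩
    k ℕ.+ L                        ∎
    where open ℕₚ.≤-Reasoning

≡ᵇ-cancelˡ : ∀ e m d → (e ℕ.+ m ℕ.≡ᵇ e ℕ.+ d) ≡ (m ℕ.≡ᵇ d)
≡ᵇ-cancelˡ zero    m d = refl
≡ᵇ-cancelˡ (suc e) m d = ≡ᵇ-cancelˡ e m d

≡ᵇ-false : ∀ {m n} → m ≢ n → (m ℕ.≡ᵇ n) ≡ false
≡ᵇ-false {m} {n} m≢n with m ℕ.≡ᵇ n in eq
... | true  = ⊥-elim (m≢n (ℕₚ.≡ᵇ⇒≡ m n (subst T (sym eq) _)))
... | false = refl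

∧-redundantʳ : ∀ b c → (b ≡ true → c ≡ true) → b ∧ c ≡ b
∧-redundantʳ true  c c-holds = c-holds refl
∧-redundantʳ false c _       = refl

∧-trueˡ : ∀ {b c} → b ∧ c ≡ true → b ≡ true
∧-trueˡ {true} _ = refl

∧-pull : ∀ e s n₁ n₂ → e ∧ s ∧ (n₁ ∧ n₂) ≡ n₁ ∧ (e ∧ s ∧ n₂)
∧-pull e     s     true  n₂ = refl
∧-pull true  true  false n₂ = refl
∧-pull true  false false n₂ = refl
∧-pull false s     false n₂ = refl

𝟙-partition : ∀ b X Y → (X ≡ true → Y ≡ true → ⊥) →
  𝟙[ b ∧ not X ∧ not Y ] + 𝟙[ b ∧ X ] + 𝟙[ b ∧ Y ] ≡ 𝟙[ b ]
𝟙-partition false X     Y     _        = refl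
𝟙-partition true  true  true  disjoint = ⊥-elim (disjoint refl refl)
𝟙-partition true  true  false _        = refl
𝟙-partition true  false true  _        = refl
𝟙-partition true  false false _        = refl

1ℤ≢0ℤ : 1ℤ ≢ 0ℤ
1ℤ≢0ℤ ()

∸-suc-+ : ∀ K {x} → suc x ≤ K → K ∸ suc x ℕ.+ x ≡ K ∸ 1
∸-suc-+ (suc K) (s≤s x≤K) = ℕₚ.m∸n+n≡m x≤K

∑paths : ℕ → (List Step → ℤ) → ℤ
∑paths zero    g = g []
∑paths (suc N) g = ∑paths N (g ∘ (U ∷_)) + ∑paths N (g ∘ (D ∷_))

∑paths-+ : ∀ N (f g : List Step → ℤ) → ∑paths N (λ p → f p + g p) ≡ ∑paths N f + ∑paths N g
∑paths-+ zero    f g = refl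
∑paths-+ (suc N) f g =
  trans (cong₂ _+_ (∑paths-+ N (f ∘ (U ∷_)) (g ∘ (U ∷_))) (∑paths-+ N (f ∘ (D ∷_)) (g ∘ (D ∷_))))
        (interchange (∑paths N (f ∘ (U ∷_))) (∑paths N (g ∘ (U ∷_)))
                     (∑paths N (f ∘ (D ∷_))) (∑paths N (g ∘ (D ∷_))))
  where
  interchange : ∀ a b c d → (a + b) + (c + d) ≡ (a + c) + (b + d)
  interchange = solve-∀

∑paths-*ˡ : ∀ N c (f : List Step → ℤ) → ∑paths N (λ p → c * f p) ≡ c * ∑paths N f
∑paths-*ˡ zero    c f = refl
∑paths-*ˡ (suc N) c f =
  trans (cong₂ _+_ (∑paths-*ˡ N c (f ∘ (U ∷_))) (∑paths-*ˡ N c (f ∘ (D ∷_)))) (sym (ℤₚ.*-distribˡ-+ c _ _))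

∑paths-cong : ∀ N {f g : List Step → ℤ} → (∀ p → length p ≡ N → f p ≡ g p) → ∑paths N f ≡ ∑paths N g
∑paths-cong zero    f≡g = f≡g [] refl
∑paths-cong (suc N) f≡g = cong₂ _+_ (∑paths-cong N (λ p ∣p∣ → f≡g (U ∷ p) (cong suc ∣p∣)))
                                    (∑paths-cong N (λ p ∣p∣ → f≡g (D ∷ p) (cong suc ∣p∣)))

∑paths-zero : ∀ N {f : List Step → ℤ} → (∀ p → length p ≡ N → f p ≡ 0ℤ) → ∑paths N f ≡ 0ℤ
∑paths-zero N {f} f≡0 = trans (∑paths-cong N {g = λ p → 0ℤ * f p} f≡0) (∑paths-*ˡ N 0ℤ f)

∑paths-++ : ∀ m n (g : List Step → ℤ) → ∑paths (m ℕ.+ n) g ≡ ∑paths m (λ p → ∑paths n (λ q → g (p ++ q)))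
∑paths-++ zero    n g = refl
∑paths-++ (suc m) n g = cong₂ _+_ (∑paths-++ m n (g ∘ (U ∷_))) (∑paths-++ m n (g ∘ (D ∷_)))

∑paths-∑ : ∀ N n (f : List Step → ℕ → ℤ) → ∑paths N (λ p → ∑ n (f p)) ≡ ∑ n (λ s → ∑paths N (λ p → f p s))
∑paths-∑ zero    n f = refl
∑paths-∑ (suc N) n f =
  trans (cong₂ _+_ (∑paths-∑ N n (f ∘ (U ∷_))) (∑paths-∑ N n (f ∘ (D ∷_))))
        (sym (∑-+ n (λ s → ∑paths N (λ p → f (U ∷ p) s)) (λ s → ∑paths N (λ p → f (D ∷ p) s))))

private
  ∑list : (List Step → ℤ) → List (List Step) → ℤ
  ∑list g []       = 0ℤ
  ∑list g (p ∷ ps) = g p + ∑list g ps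

  count≡∑list : ∀ (P : List Step → Bool) ps →
    + length (filter (λ p → T? (P p)) ps) ≡ ∑list (λ p → 𝟙[ P p ]) ps
  count≡∑list P []       = refl
  count≡∑list P (p ∷ ps) with P p
  ... | true  = trans (ℤₚ.pos-+ 1 _) (cong (_+_ 1ℤ) (count≡∑list P ps))
  ... | false = trans (count≡∑list P ps) (sym (ℤₚ.+-identityˡ _))

  ∑list-concatMap : ∀ g ps → ∑list g (concatMap (λ p → (U ∷ p) ∷ (D ∷ p) ∷ []) ps) ≡
                             ∑list (λ p → g (U ∷ p) + g (D ∷ p)) ps
  ∑list-concatMap g []       = refl
  ∑list-concatMap g (p ∷ ps) =
    trans (sym (ℤₚ.+-assoc (g (U ∷ p)) (g (D ∷ p)) _)) (cong (_+_ (g (U ∷ p) + g (D ∷ p))) (∑list-concatMap g ps))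

  ∑list-allPaths : ∀ N g → ∑list g (allPaths N) ≡ ∑paths N g
  ∑list-allPaths zero    g = ℤₚ.+-identityʳ (g [])
  ∑list-allPaths (suc N) g =
    trans (∑list-concatMap g (allPaths N))
          (trans (∑list-allPaths N (λ p → g (U ∷ p) + g (D ∷ p))) (∑paths-+ N (g ∘ (U ∷_)) (g ∘ (D ∷_))))

count≡∑paths : ∀ N (P : List Step → Bool) →
  + length (filter (λ p → T? (P p)) (allPaths N)) ≡ ∑paths N (λ p → 𝟙[ P p ])
count≡∑paths N P = trans (count≡∑list P (allPaths N)) (∑list-allPaths N (λ p → 𝟙[ P p ]))

downs : List Step → ℕ
downs []      = 0
downs (U ∷ p) = downs p
downs (D ∷ p) = suc (downs p)

downs-++ : ∀ p q → downs (p ++ q) ≡ downs p ℕ.+ downs q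
downs-++ []      q = refl
downs-++ (U ∷ p) q = downs-++ p q
downs-++ (D ∷ p) q = cong suc (downs-++ p q)

allUp : List Step → Bool
allUp []      = true
allUp (U ∷ p) = allUp p
allUp (D ∷ p) = false

downs≡0⇒allUp : ∀ q → downs q ≡ 0 → allUp q ≡ true
downs≡0⇒allUp []      _ = refl
downs≡0⇒allUp (U ∷ q) d≡0 = downs≡0⇒allUp q d≡0

downs≥1⇒¬allUp : ∀ q → 1 ≤ downs q → allUp q ≡ false
downs≥1⇒¬allUp (U ∷ q) d≥1 = downs≥1⇒¬allUp q d≥1
downs≥1⇒¬allUp (D ∷ q) _   = refl

allUp-drop : ∀ t q → allUp q ≡ true → allUp (drop t q) ≡ true
allUp-drop zero    q       up = up
allUp-drop (suc t) []      _  = refl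
allUp-drop (suc t) (U ∷ q) up = allUp-drop t q up

allUp-drop-∷ : ∀ c s q → 1 ≤ downs q →
  allUp (drop (length (s ∷ q) ∸ c) (s ∷ q)) ≡ allUp (drop (length q ∸ c) q)
allUp-drop-∷ c s q d≥1 with c ℕₚ.≤? length q
... | yes c≤∣q∣ = cong (λ n → allUp (drop n (s ∷ q))) (ℕₚ.+-∸-assoc 1 c≤∣q∣)
... | no  c≰∣q∣ = begin
  allUp (drop (suc (length q) ∸ c) (s ∷ q)) ≡⟨ cong (λ n → allUp (drop n (s ∷ q))) (ℕₚ.m≤n⇒m∸n≡0 ∣q∣<c) ⟩
  allUp (s ∷ q)                             ≡⟨ downs≥1⇒¬allUp (s ∷ q) (ℕₚ.≤-trans d≥1 (downs-∷ s q)) ⟩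
  false                                     ≡⟨ downs≥1⇒¬allUp q d≥1 ⟨
  allUp q                                   ≡⟨ cong (λ n → allUp (drop n q)) (ℕₚ.m≤n⇒m∸n≡0 (ℕₚ.<⇒≤ ∣q∣<c)) ⟨
  allUp (drop (length q ∸ c) q)             ∎
  where
  open ≡-Reasoning
  ∣q∣<c : length q < c
  ∣q∣<c = ℕₚ.≰⇒> c≰∣q∣
  downs-∷ : ∀ s q → downs q ≤ downs (s ∷ q)
  downs-∷ U q = ℕₚ.≤-refl
  downs-∷ D q = ℕₚ.n≤1+n (downs q)

startsWithURD⇒length : ∀ r x → startsWithURD r x ≡ true → suc r ≤ length x
startsWithURD⇒length zero    (D ∷ x) _ = s≤s z≤n
startsWithURD⇒length (suc r) (U ∷ x) p = s≤s (startsWithURD⇒length r x p)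

startsWithURD-short : ∀ r x → length x ≤ r → startsWithURD r x ≡ false
startsWithURD-short r x ∣x∣≤r with startsWithURD r x in p
... | false = refl
... | true  = ⊥-elim (ℕₚ.<⇒≱ (startsWithURD⇒length r x p) ∣x∣≤r)

startsWithURD⇒downs≡1 : ∀ r x → startsWithURD r x ≡ true → length x ≡ suc r → downs x ≡ 1
startsWithURD⇒downs≡1 zero    (D ∷ []) _ _ = refl
startsWithURD⇒downs≡1 (suc r) (U ∷ x)  p ∣x∣ = startsWithURD⇒downs≡1 r x p (ℕₚ.suc-injective ∣x∣)

startsWithURD⇒¬allUp-drop : ∀ r x → startsWithURD r x ≡ true → allUp (drop r x) ≡ false
startsWithURD⇒¬allUp-drop zero    (D ∷ x) _ = refl
startsWithURD⇒¬allUp-drop (suc r) (U ∷ x) p = startsWithURD⇒¬allUp-drop r x p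

drop-length-++ : ∀ (p q : List Step) → drop (length p) (p ++ q) ≡ q
drop-length-++ []      q = refl
drop-length-++ (_ ∷ p) q = drop-length-++ p q

onePlusT⊛-zero : ∀ f → (onePlusT ⊛ f) 0 ≡ f 0
onePlusT⊛-zero f = trans (ℤₚ.+-identityʳ _) (ℤₚ.*-identityˡ (f 0))

onePlusT⊛-suc : ∀ f d → (onePlusT ⊛ f) (suc d) ≡ f (suc d) + f d
onePlusT⊛-suc f d = trans (sumTo≡∑ (suc (suc d)) (λ i → onePlusT i * f (suc d ∸ i)))
  (cong₂ _+_ (ℤₚ.*-identityˡ (f (suc d)))
             (trans (cong₂ _+_ (ℤₚ.*-identityˡ (f d)) (∑-zero d (λ _ _ → refl))) (ℤₚ.+-identityʳ (f d))))

onePlusT^-zero : ∀ N → (onePlusT ^S N) 0 ≡ 1ℤ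
onePlusT^-zero zero    = refl
onePlusT^-zero (suc N) = trans (onePlusT⊛-zero (onePlusT ^S N)) (onePlusT^-zero N)

-- Both sides satisfy Pascal's rule.
∑paths-downs≡binomial : ∀ N d → ∑paths N (λ p → 𝟙[ downs p ℕ.≡ᵇ d ]) ≡ (onePlusT ^S N) d
∑paths-downs≡binomial zero    zero    = refl
∑paths-downs≡binomial zero    (suc d) = refl
∑paths-downs≡binomial (suc N) zero    =
  trans (cong₂ _+_ (∑paths-downs≡binomial N zero) (∑paths-zero N (λ _ _ → refl)))
        (trans (ℤₚ.+-identityʳ _) (sym (onePlusT⊛-zero (onePlusT ^S N))))
∑paths-downs≡binomial (suc N) (suc d) =
  trans (cong₂ _+_ (∑paths-downs≡binomial N (suc d)) (∑paths-downs≡binomial N d))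
        (sym (onePlusT⊛-suc (onePlusT ^S N) d))

∑paths-allUp : ∀ c (Q : ℕ → Bool) → ∑paths c (λ y → 𝟙[ Q (downs y) ∧ allUp y ]) ≡ 𝟙[ Q 0 ]
∑paths-allUp zero    Q = cong 𝟙[_] (BP.∧-identityʳ (Q 0))
∑paths-allUp (suc c) Q =
  trans (cong₂ _+_ (∑paths-allUp c Q) (∑paths-zero c (λ y _ → cong 𝟙[_] (BP.∧-zeroʳ (Q (suc (downs y)))))))
        (ℤₚ.+-identityʳ _)

∑paths-URD : ∀ r (Q : ℕ → Bool) → ∑paths (suc r) (λ y → 𝟙[ Q (downs y) ∧ startsWithURD r y ]) ≡ 𝟙[ Q 1 ]
∑paths-URD zero    Q =
  trans (cong₂ _+_ (cong 𝟙[_] (BP.∧-zeroʳ (Q 0))) (cong 𝟙[_] (BP.∧-identityʳ (Q 1)))) (ℤₚ.+-identityˡ _)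
∑paths-URD (suc r) Q =
  trans (cong₂ _+_ (∑paths-URD r Q) (∑paths-zero (suc r) (λ y _ → cong 𝟙[_] (BP.∧-zeroʳ (Q (suc (downs y)))))))
        (ℤₚ.+-identityʳ _)


-- When P admits exactly one word of length c, with e down steps, only the prefix of
-- length K - c is free.
∑paths-suffix : ∀ K c e d (P : List Step → Bool) → c ≤ K →
  (∀ Q → ∑paths c (λ y → 𝟙[ Q (downs y) ∧ P y ]) ≡ 𝟙[ Q e ]) →
  ∑paths K (λ q → 𝟙[ (downs q ℕ.≡ᵇ e ℕ.+ d) ∧ P (drop (K ∸ c) q) ]) ≡ (onePlusT ^S (K ∸ c)) d
∑paths-suffix K c e d P c≤K unique = begin
  ∑paths K f
    ≡⟨ cong (λ L → ∑paths L f) (ℕₚ.m∸n+n≡m c≤K) ⟨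
  ∑paths (K ∸ c ℕ.+ c) f
    ≡⟨ ∑paths-++ (K ∸ c) c f ⟩
  ∑paths (K ∸ c) (λ x → ∑paths c (λ y → f (x ++ y)))
    ≡⟨ ∑paths-cong (K ∸ c) (λ x ∣x∣ → trans (∑paths-cong c (λ y _ → cong 𝟙[_] (split x y ∣x∣))) (prefix x)) ⟩
  ∑paths (K ∸ c) (λ x → 𝟙[ downs x ℕ.≡ᵇ d ])
    ≡⟨ ∑paths-downs≡binomial (K ∸ c) d ⟩
  (onePlusT ^S (K ∸ c)) d
    ∎
  where
  open ≡-Reasoning
  f : List Step → ℤ
  f q = 𝟙[ (downs q ℕ.≡ᵇ e ℕ.+ d) ∧ P (drop (K ∸ c) q) ]
  split : ∀ x y → length x ≡ K ∸ c → ((downs (x ++ y) ℕ.≡ᵇ e ℕ.+ d) ∧ P (drop (K ∸ c) (x ++ y))) ≡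
                                      ((downs x ℕ.+ downs y ℕ.≡ᵇ e ℕ.+ d) ∧ P y)
  split x y ∣x∣ = cong₂ _∧_ (cong (ℕ._≡ᵇ e ℕ.+ d) (downs-++ x y))
                           (cong P (trans (cong (λ n → drop n (x ++ y)) (sym ∣x∣)) (drop-length-++ x y)))
  prefix : ∀ x → ∑paths c (λ y → 𝟙[ (downs x ℕ.+ downs y ℕ.≡ᵇ e ℕ.+ d) ∧ P y ]) ≡ 𝟙[ downs x ℕ.≡ᵇ d ]
  prefix x = trans (unique (λ n → downs x ℕ.+ n ℕ.≡ᵇ e ℕ.+ d))
                   (cong 𝟙[_] (trans (cong (ℕ._≡ᵇ e ℕ.+ d) (ℕₚ.+-comm (downs x) e)) (≡ᵇ-cancelˡ e (downs x) d)))

module Heights (k : ℕ) where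

  endHeight-++ : ∀ h p q → endHeight k h (p ++ q) ≡ endHeight k (endHeight k h p) q
  endHeight-++ h []      q = refl
  endHeight-++ h (s ∷ p) q = endHeight-++ (h + δ k s) p q

  staysAbove-++ : ∀ a h p q → staysAbove k a h (p ++ q) ≡ staysAbove k a h p ∧ staysAbove k a (endHeight k h p) q
  staysAbove-++ a h []      q = refl
  staysAbove-++ a h (s ∷ p) q =
    trans (cong (step ∧_) (staysAbove-++ a (h + δ k s) p q))
          (sym (BP.∧-assoc step (staysAbove k a (h + δ k s) p) (staysAbove k a (endHeight k (h + δ k s) p) q)))
    where
    step : Bool
    step = - + a ℤ.≤ᵇ h + δ k s

  endHeight+downs : ∀ h q → endHeight k h q + + (k ℕ.* downs q) ≡ h + + length q
  endHeight+downs h []      = cong (λ x → h + + x) (ℕₚ.*-zeroʳ k)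
  endHeight+downs h (U ∷ q) = trans (endHeight+downs (h + 1ℤ) q) (ℤₚ.+-assoc h 1ℤ _)
  endHeight+downs h (D ∷ q) = begin
    e + + (k ℕ.* suc (downs q))       ≡⟨ cong (λ x → e + + x) (ℕₚ.*-suc k (downs q)) ⟩
    e + + (k ℕ.+ k ℕ.* downs q)       ≡⟨ cong (_+_ e) (ℤₚ.pos-+ k _) ⟩
    e + (+ k + + (k ℕ.* downs q))     ≡⟨ rearrange e (+ k) (+ (k ℕ.* downs q)) ⟩
    (e + + (k ℕ.* downs q)) + + k     ≡⟨ cong (_+ + k) (endHeight+downs (h + (1ℤ - + k)) q) ⟩
    h + (1ℤ - + k) + + length q + + k ≡⟨ cancel h (+ k) (+ length q) ⟩
    h + (1ℤ + + length q)             ∎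
    where
    open ≡-Reasoning
    e : ℤ
    e = endHeight k (h + (1ℤ - + k)) q
    rearrange : ∀ e K X → e + (K + X) ≡ (e + X) + K
    rearrange = solve-∀
    cancel : ∀ h K L → h + (1ℤ - K) + L + K ≡ h + (1ℤ + L)
    cancel = solve-∀

  endHeight≤ : ∀ h q → endHeight k h q ℤ.≤ h + + length q
  endHeight≤ h q = subst (endHeight k h q ℤ.≤_) (endHeight+downs h q) (ℤₚ.i≤i+j (endHeight k h q) (+ (k ℕ.* downs q)))

  staysAbove⇒endHeight≥ : ∀ a h p → staysAbove k a h p ≡ true → - + a ℤ.≤ h → - + a ℤ.≤ endHeight k h p
  staysAbove⇒endHeight≥ a h []      _  -a≤h = -a≤h
  staysAbove⇒endHeight≥ a h (s ∷ p) st _    with - + a ℤ.≤ᵇ h + δ k s in step | st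
  ... | true  | rest = staysAbove⇒endHeight≥ a (h + δ k s) p rest (ℤₚ.≤ᵇ⇒≤ (Equivalence.from BP.T-≡ step))
  ... | false | ()

  InGap : ℤ → Set
  InGap e = 1ℤ ℤ.≤ e × e ℤ.≤ + (k ∸ 1)

  module _ .{{_ : ℕ.NonZero k}} where

    endHeight≡k*⇒≤ : ∀ {m n} p → length p ≡ k ℕ.* n → endHeight k 0ℤ p ≡ + (k ℕ.* m) → m ≤ n
    endHeight≡k*⇒≤ p ∣p∣ end≡ with subst₂ ℤ._≤_ end≡ (cong (λ L → 0ℤ + + L) ∣p∣) (endHeight≤ 0ℤ p)
    ... | +≤+ km≤kn = ℕₚ.*-cancelˡ-≤ k km≤kn

    endHeight≡⊖ : ∀ n p → length p ≡ k ℕ.* n → endHeight k 0ℤ p ≡ (k ℕ.* n) ⊖ (k ℕ.* downs p)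
    endHeight≡⊖ n p ∣p∣ = x+L≡M⇒x≡M⊖L _ _ _ (trans (endHeight+downs 0ℤ p) (cong (λ L → 0ℤ + + L) ∣p∣))

    -- After kn steps the height is a multiple of k, and a negative multiple would be ≤ -k < -a.
    staysAbove⇒endHeight≡k* : ∀ {a} n p → a < k → length p ≡ k ℕ.* n → staysAbove k a 0ℤ p ≡ true →
      Σ ℕ λ s → endHeight k 0ℤ p ≡ + (k ℕ.* s) × s ≤ n
    staysAbove⇒endHeight≡k* {a} n p a<k ∣p∣ st with downs p ℕₚ.≤? n
    ... | yes d≤n = n ∸ downs p , end≡ , ℕₚ.m∸n≤m n (downs p)
      where
      end≡ : endHeight k 0ℤ p ≡ + (k ℕ.* (n ∸ downs p))
      end≡ = trans (endHeight≡⊖ n p ∣p∣)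
                   (trans (ℤₚ.⊖-≥ (ℕₚ.*-monoʳ-≤ k d≤n)) (cong +_ (sym (ℕₚ.*-distribˡ-∸ k n (downs p)))))
    ... | no d≰n = ⊥-elim (ℕₚ.<⇒≱ a<k (ℕₚ.≤-trans k≤depth depth≤a))
      where
      n<d : n < downs p
      n<d = ℕₚ.≰⇒> d≰n
      depth : ℕ
      depth = k ℕ.* (downs p ∸ n)
      end≡ : endHeight k 0ℤ p ≡ - + depth
      end≡ = trans (endHeight≡⊖ n p ∣p∣)
                   (trans (ℤₚ.⊖-≤ (ℕₚ.*-monoʳ-≤ k (ℕₚ.<⇒≤ n<d))) (cong (-_ ∘ +_) (sym (ℕₚ.*-distribˡ-∸ k (downs p) n))))
      depth≤a : depth ℕ.≤ a
      depth≤a with ℤₚ.neg-cancel-≤ (subst (- + a ℤ.≤_) end≡ (staysAbove⇒endHeight≥ a 0ℤ p st ℤₚ.neg-≤-pos))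
      ... | +≤+ depth≤a = depth≤a
      k≤depth : k ℕ.≤ depth
      k≤depth = ℕₚ.m≤m*n k (downs p ∸ n) {{ℕ.>-nonZero (ℕₚ.m<n⇒0<n∸m n<d)}}

    endHeight-block : ∀ s q → length q ≡ k → endHeight k (+ (k ℕ.* s)) q + + (k ℕ.* downs q) ≡ + (k ℕ.* suc s)
    endHeight-block s q ∣q∣ = trans (endHeight+downs (+ (k ℕ.* s)) q)
      (trans (cong (λ L → + (k ℕ.* s) + + L) ∣q∣)
             (cong +_ (trans (ℕₚ.+-comm (k ℕ.* s) k) (sym (ℕₚ.*-suc k s)))))

    ⌊endHeight≟⌋-block : ∀ s m q → length q ≡ k →
      ⌊ endHeight k (+ (k ℕ.* s)) q ℤ.≟ + (k ℕ.* m) ⌋ ≡ (m ℕ.+ downs q ℕ.≡ᵇ suc s)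
    ⌊endHeight≟⌋-block s m q ∣q∣ = ⌊⌋≡≡ᵇ (endHeight k (+ (k ℕ.* s)) q ℤ.≟ + (k ℕ.* m)) to from
      where
      d : ℕ
      d = downs q
      to : endHeight k (+ (k ℕ.* s)) q ≡ + (k ℕ.* m) → m ℕ.+ d ≡ suc s
      to end≡ = ℕₚ.*-cancelˡ-≡ (m ℕ.+ d) (suc s) k (ℤₚ.+-injective (begin
        + (k ℕ.* (m ℕ.+ d))                         ≡⟨ cong +_ (ℕₚ.*-distribˡ-+ k m d) ⟩
        + (k ℕ.* m ℕ.+ k ℕ.* d)                     ≡⟨ ℤₚ.pos-+ (k ℕ.* m) (k ℕ.* d) ⟩
        + (k ℕ.* m) + + (k ℕ.* d)                   ≡⟨ cong (_+ + (k ℕ.* d)) end≡ ⟨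
        endHeight k (+ (k ℕ.* s)) q + + (k ℕ.* d)   ≡⟨ endHeight-block s q ∣q∣ ⟩
        + (k ℕ.* suc s)                             ∎))
        where open ≡-Reasoning
      from : m ℕ.+ d ≡ suc s → endHeight k (+ (k ℕ.* s)) q ≡ + (k ℕ.* m)
      from m+d≡1+s = +-cancelʳ (+ (k ℕ.* d)) _ _ (begin
        endHeight k (+ (k ℕ.* s)) q + + (k ℕ.* d)   ≡⟨ endHeight-block s q ∣q∣ ⟩
        + (k ℕ.* suc s)                             ≡⟨ cong (λ x → + (k ℕ.* x)) m+d≡1+s ⟨
        + (k ℕ.* (m ℕ.+ d))                         ≡⟨ cong +_ (ℕₚ.*-distribˡ-+ k m d) ⟩
        + (k ℕ.* m ℕ.+ k ℕ.* d)                     ≡⟨ ℤₚ.pos-+ (k ℕ.* m) (k ℕ.* d) ⟩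
        + (k ℕ.* m) + + (k ℕ.* d)                   ∎)
        where open ≡-Reasoning

    ¬InGap-k* : ∀ s → ¬ InGap (+ (k ℕ.* s))
    ¬InGap-k* zero    (1≤k*0 , _) with +≤+ () ← subst (1ℤ ℤ.≤_) (cong +_ (ℕₚ.*-zeroʳ k)) 1≤k*0
    ¬InGap-k* (suc s) (_ , +≤+ k*[1+s]≤k-1) =
      ℕₚ.<⇒≱ (ℕₚ.∸-monoʳ-< {k} (s≤s z≤n) (ℕ.>-nonZero⁻¹ k)) (ℕₚ.≤-trans (ℕₚ.m≤m*n k (suc s)) k*[1+s]≤k-1)

  patternEndsAtZero : ℕ → ℤ → Bool
  patternEndsAtZero r h = ⌊ h + + r + 1ℤ - + k ℤ.≟ 0ℤ ⌋

  patternEndsAtZero-suc : ∀ r h → patternEndsAtZero (suc r) h ≡ patternEndsAtZero r (h + 1ℤ)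
  patternEndsAtZero-suc r h = cong (λ x → ⌊ x ℤ.≟ 0ℤ ⌋) (shift h (+ r) (+ k))
    where
    shift : ∀ h R K → h + (1ℤ + R) + 1ℤ - K ≡ h + 1ℤ + R + 1ℤ - K
    shift = solve-∀

  patternEndsAtZero⇒ : ∀ r h → patternEndsAtZero r h ≡ true → h + + r + 1ℤ ≡ + k
  patternEndsAtZero⇒ r h ends =
    trans (cancel (h + + r + 1ℤ) (+ k)) (trans (cong (_+ + k) (⌊⌋-sound (h + + r + 1ℤ - + k ℤ.≟ 0ℤ) ends)) (ℤₚ.+-identityˡ _))
    where
    cancel : ∀ x K → x ≡ x - K + K
    cancel = solve-∀

  patternEndsAtZero⇐ : ∀ r h → h + + r + 1ℤ ≡ + k → patternEndsAtZero r h ≡ true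
  patternEndsAtZero⇐ r h eq = ⌊⌋-true (h + + r + 1ℤ - + k ℤ.≟ 0ℤ) (trans (cong (_- + k) eq) (ℤₚ.+-inverseʳ (+ k)))


  -- A factor U^r D ending at height 0 and cut after t ∈ [1, r] of its steps is cut at
  -- height k - 1 - r + t ∈ [1, k - 1]; so away from such heights the factor cannot straddle.
  startsWithURD-++ : ∀ r s x q h → suc r ≤ k → ¬ InGap (endHeight k h (s ∷ x)) →
    (startsWithURD r ((s ∷ x) ++ q) ∧ patternEndsAtZero r h) ≡ (startsWithURD r (s ∷ x) ∧ patternEndsAtZero r h)
  startsWithURD-++ zero    D x       q h _   _   = refl
  startsWithURD-++ zero    U x       q h _   _   = refl
  startsWithURD-++ (suc r) D x       q h _   _   = refl
  startsWithURD-++ (suc r) U []      q h r<k ¬gap with patternEndsAtZero (suc r) h in ends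
  ... | false = trans (BP.∧-zeroʳ _) (sym (BP.∧-zeroʳ _))
  ... | true  = ⊥-elim (¬gap (1≤h+1 , h+1≤k-1))
    where
    h+1≡k-[1+r] : h + 1ℤ ≡ + (k ∸ suc r)
    h+1≡k-[1+r] = trans (x+L≡M⇒x≡M⊖L (h + 1ℤ) (suc r) k (trans (rearrange h (+ r)) (patternEndsAtZero⇒ (suc r) h ends)))
                        (ℤₚ.⊖-≥ (ℕₚ.<⇒≤ r<k))
      where
      rearrange : ∀ h R → h + 1ℤ + (1ℤ + R) ≡ h + (1ℤ + R) + 1ℤ
      rearrange = solve-∀
    1≤h+1 : 1ℤ ℤ.≤ h + 1ℤ
    1≤h+1 = subst (1ℤ ℤ.≤_) (sym h+1≡k-[1+r]) (+≤+ (ℕₚ.m<n⇒0<n∸m r<k))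
    h+1≤k-1 : h + 1ℤ ℤ.≤ + (k ∸ 1)
    h+1≤k-1 = subst (ℤ._≤ + (k ∸ 1)) (sym h+1≡k-[1+r]) (+≤+ (ℕₚ.∸-monoʳ-≤ k (s≤s z≤n)))
  startsWithURD-++ (suc r) U (s ∷ x) q h r<k ¬gap =
    trans (cong (startsWithURD r ((s ∷ x) ++ q) ∧_) (patternEndsAtZero-suc r h))
          (trans (startsWithURD-++ r s x q (h + 1ℤ) (ℕₚ.<⇒≤ r<k) ¬gap)
                 (cong (startsWithURD r (s ∷ x) ∧_) (sym (patternEndsAtZero-suc r h))))

  noBadPattern-++ : ∀ r p q h → suc r ≤ k → ¬ InGap (endHeight k h p) →
    noBadPattern k r h (p ++ q) ≡ noBadPattern k r h p ∧ noBadPattern k r (endHeight k h p) q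
  noBadPattern-++ r []      q h _   _    = refl
  noBadPattern-++ r (s ∷ p) q h r<k ¬gap =
    trans (cong₂ (λ x y → not x ∧ y) (startsWithURD-++ r s p q h r<k ¬gap) (noBadPattern-++ r p q (h + δ k s) r<k ¬gap))
          (sym (BP.∧-assoc (not (startsWithURD r (s ∷ p) ∧ patternEndsAtZero r h)) (noBadPattern k r (h + δ k s) p) _))

  AllPositive : ℤ → List Step → Set
  AllPositive h []      = ⊤
  AllPositive h (s ∷ q) = 1ℤ ℤ.≤ h + δ k s × AllPositive (h + δ k s) q

  -- Fewer than k steps remain after any point, and each raises the height by at most 1.
  endHeight≥k⇒AllPositive : ∀ h q → length q ≤ k → + k ℤ.≤ endHeight k h q → AllPositive h q
  endHeight≥k⇒AllPositive h []      _    _       = tt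
  endHeight≥k⇒AllPositive h (s ∷ q) ∣q∣<k k≤end =
    1≤h′ , endHeight≥k⇒AllPositive h′ q (ℕₚ.<⇒≤ ∣q∣<k) k≤end
    where
    h′ : ℤ
    h′ = h + δ k s
    1≤k-∣q∣ : 1ℤ ℤ.≤ + k - + length q
    1≤k-∣q∣ = subst (1ℤ ℤ.≤_) (sym (trans (ℤₚ.m-n≡m⊖n k (length q)) (ℤₚ.⊖-≥ (ℕₚ.<⇒≤ ∣q∣<k))))
                    (+≤+ (ℕₚ.m<n⇒0<n∸m ∣q∣<k))
    1≤h′ : 1ℤ ℤ.≤ h′
    1≤h′ = ℤₚ.≤-trans 1≤k-∣q∣ (ℤₚ.≤-trans (ℤₚ.+-monoˡ-≤ (- + length q) (ℤₚ.≤-trans k≤end (endHeight≤ h′ q)))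
                                          (ℤₚ.≤-reflexive (cancel h′ (+ length q))))
      where
      cancel : ∀ x y → x + y - y ≡ x
      cancel = solve-∀

  AllPositive⇒staysAbove : ∀ a h q → AllPositive h q → staysAbove k a h q ≡ true
  AllPositive⇒staysAbove a h []      _          = refl
  AllPositive⇒staysAbove a h (s ∷ q) (1≤h′ , ps) =
    cong₂ _∧_ (≤ᵇ-true (ℤₚ.≤-trans (ℤₚ.neg-≤-pos {a}) (ℤₚ.≤-trans (+≤+ z≤n) 1≤h′)))
              (AllPositive⇒staysAbove a (h + δ k s) q ps)

  AllPositive⇒¬patternEndsAtZero : ∀ r h x → startsWithURD r x ≡ true → AllPositive h x →
    patternEndsAtZero r h ≡ false
  AllPositive⇒¬patternEndsAtZero zero    h (D ∷ x) _ (1≤h′ , _) =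
    ⌊⌋-false (h + + 0 + 1ℤ - + k ℤ.≟ 0ℤ) (λ eq → ℤₚ.<-irrefl refl (ℤₚ.<-≤-trans (ℤ.+<+ (s≤s z≤n))
      (subst (1ℤ ℤ.≤_) (trans (rearrange h (+ k)) eq) 1≤h′)))
    where
    rearrange : ∀ h K → h + (1ℤ - K) ≡ h + 0ℤ + 1ℤ - K
    rearrange = solve-∀
  AllPositive⇒¬patternEndsAtZero (suc r) h (U ∷ x) p (_ , ps) =
    trans (patternEndsAtZero-suc r h) (AllPositive⇒¬patternEndsAtZero r (h + 1ℤ) x p ps)

  AllPositive⇒noBadPattern : ∀ r h q → AllPositive h q → noBadPattern k r h q ≡ true
  AllPositive⇒noBadPattern r h []      _ = refl
  AllPositive⇒noBadPattern r h (s ∷ q) ps@(_ , ps′) with startsWithURD r (s ∷ q) in p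
  ... | false = AllPositive⇒noBadPattern r (h + δ k s) q ps′
  ... | true  = trans (cong (λ b → not b ∧ noBadPattern k r (h + δ k s) q)
                            (AllPositive⇒¬patternEndsAtZero r h (s ∷ q) p ps))
                      (AllPositive⇒noBadPattern r (h + δ k s) q ps′)

  ReturnsToZero : ℤ → List Step → Set
  ReturnsToZero h q = h + + length q ≡ + (k ℕ.* downs q)

  ReturnsToZero-∷ : ∀ s h q → ReturnsToZero h (s ∷ q) → ReturnsToZero (h + δ k s) q
  ReturnsToZero-∷ U h q ret = trans (ℤₚ.+-assoc h 1ℤ _) ret
  ReturnsToZero-∷ D h q ret = begin
    h + (1ℤ - + k) + + length q     ≡⟨ rearrange h (+ k) (+ length q) ⟩
    h + (1ℤ + + length q) - + k     ≡⟨ cong (_- + k) ret ⟩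
    + (k ℕ.* suc (downs q)) - + k   ≡⟨ cong (λ x → + x - + k) (ℕₚ.*-suc k (downs q)) ⟩
    + (k ℕ.+ k ℕ.* downs q) - + k   ≡⟨ cong (_- + k) (ℤₚ.pos-+ k _) ⟩
    + k + + (k ℕ.* downs q) - + k   ≡⟨ cancel (+ k) (+ (k ℕ.* downs q)) ⟩
    + (k ℕ.* downs q)               ∎
    where
    open ≡-Reasoning
    rearrange : ∀ h K L → h + (1ℤ - K) + L ≡ h + (1ℤ + L) - K
    rearrange = solve-∀
    cancel : ∀ K X → K + X - K ≡ X
    cancel = solve-∀

  ReturnsToZero⇒0≤ : ∀ h q → length q ≤ k → 1 ≤ downs q → ReturnsToZero h q → 0ℤ ℤ.≤ h
  ReturnsToZero⇒0≤ h q ∣q∣≤k d≥1 ret =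
    subst (0ℤ ℤ.≤_) (sym (trans (x+L≡M⇒x≡M⊖L h (length q) (k ℕ.* downs q) ret) (ℤₚ.⊖-≥ ∣q∣≤kd))) (+≤+ z≤n)
    where
    ∣q∣≤kd : length q ≤ k ℕ.* downs q
    ∣q∣≤kd = ℕₚ.≤-trans ∣q∣≤k (subst (_≤ k ℕ.* downs q) (ℕₚ.*-identityʳ k) (ℕₚ.*-monoʳ-≤ k d≥1))

  allUp⇒staysAbove : ∀ a h q → allUp q ≡ true → - + a ℤ.≤ h → staysAbove k a h q ≡ true
  allUp⇒staysAbove a h []      _  _    = refl
  allUp⇒staysAbove a h (U ∷ q) up -a≤h = cong₂ _∧_ (≤ᵇ-true -a≤h+1) (allUp⇒staysAbove a (h + 1ℤ) q up -a≤h+1)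
    where
    -a≤h+1 : - + a ℤ.≤ h + 1ℤ
    -a≤h+1 = ℤₚ.≤-trans -a≤h (ℤₚ.i≤i+j h 1ℤ)

  ReturnsToZero-D∷allUp : ∀ h q → downs q ≡ 0 → ReturnsToZero h (D ∷ q) → h + δ k D ≡ - + length q
  ReturnsToZero-D∷allUp h q d≡0 ret = trans (x+L≡M⇒x≡M⊖L (h + δ k D) (length q) 0 ret′) (ℤₚ.⊖-≤ z≤n)
    where
    ret′ : h + δ k D + + length q ≡ + 0
    ret′ = trans (ReturnsToZero-∷ D h q ret) (cong +_ (trans (cong (k ℕ.*_) d≡0) (ℕₚ.*-zeroʳ k)))

  staysAbove-D∷allUp : ∀ a h q → downs q ≡ 0 → ReturnsToZero h (D ∷ q) →
    staysAbove k a h (D ∷ q) ≡ not (allUp (drop (length q ∸ a) (D ∷ q)))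
  staysAbove-D∷allUp a h q d≡0 ret with length q ∸ a in ∣q∣∸a
  ... | zero  = cong₂ _∧_ (≤ᵇ-true -a≤h′) (allUp⇒staysAbove a (h + δ k D) q (downs≡0⇒allUp q d≡0) -a≤h′)
    where
    -a≤h′ : - + a ℤ.≤ h + δ k D
    -a≤h′ = subst (- + a ℤ.≤_) (sym (ReturnsToZero-D∷allUp h q d≡0 ret))
                  (ℤₚ.neg-mono-≤ (+≤+ (ℕₚ.m∸n≡0⇒m≤n ∣q∣∸a)))
  ... | suc t = trans (cong (_∧ staysAbove k a (h + δ k D) q) (≤ᵇ-false -a≰h′))
                      (cong not (sym (allUp-drop t q (downs≡0⇒allUp q d≡0))))
    where
    -a≰h′ : ¬ (- + a ℤ.≤ h + δ k D)
    -a≰h′ -a≤h′ with ℤₚ.neg-cancel-≤ (subst (- + a ℤ.≤_) (ReturnsToZero-D∷allUp h q d≡0 ret) -a≤h′)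
    ... | +≤+ ∣q∣≤a = ℕₚ.0≢1+n (trans (sym (ℕₚ.m≤n⇒m∸n≡0 ∣q∣≤a)) ∣q∣∸a)

  -- The minimum of a returning block with some D lies at its last D.
  staysAbove-returning : ∀ a h q → length q ≤ k → 1 ≤ downs q → ReturnsToZero h q →
    staysAbove k a h q ≡ not (allUp (drop (length q ∸ suc a) q))
  staysAbove-returning a h (s ∷ q) ∣q∣<k d≥1 ret with 1 ℕₚ.≤? downs q
  ... | yes q-has-D =
    trans (cong₂ _∧_ (≤ᵇ-true (ℤₚ.≤-trans (ℤₚ.neg-≤-pos {a}) 0≤h′))
                     (staysAbove-returning a (h + δ k s) q (ℕₚ.<⇒≤ ∣q∣<k) q-has-D ret′))
          (cong not (sym (allUp-drop-∷ (suc a) s q q-has-D)))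
    where
    ret′ : ReturnsToZero (h + δ k s) q
    ret′ = ReturnsToZero-∷ s h q ret
    0≤h′ : 0ℤ ℤ.≤ h + δ k s
    0≤h′ = ReturnsToZero⇒0≤ (h + δ k s) q (ℕₚ.<⇒≤ ∣q∣<k) q-has-D ret′
  ... | no q-all-up with s
  ...   | U = ⊥-elim (q-all-up d≥1)
  ...   | D = staysAbove-D∷allUp a h q (ℕₚ.n<1⇒n≡0 (ℕₚ.≰⇒> q-all-up)) ret

  patternEndsAtZero⇒length : ∀ r h s q → suc r ≤ k → length (s ∷ q) ≤ k →
    patternEndsAtZero r h ≡ true → ReturnsToZero h (s ∷ q) → r ≡ length q
  patternEndsAtZero⇒length r h s q r<k ∣q∣<k ends ret =
    k*d+r≡k+L⇒r≡L k (downs (s ∷ q)) r<k ∣q∣<k (ℤₚ.+-injective (begin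
      + (k ℕ.* downs (s ∷ q) ℕ.+ r)       ≡⟨ ℤₚ.pos-+ (k ℕ.* downs (s ∷ q)) r ⟩
      + (k ℕ.* downs (s ∷ q)) + + r       ≡⟨ cong (_+ + r) ret ⟨
      h + (1ℤ + + length q) + + r         ≡⟨ rearrange h (+ r) (+ length q) ⟩
      h + + r + 1ℤ + + length q           ≡⟨ cong (_+ + length q) (patternEndsAtZero⇒ r h ends) ⟩
      + k + + length q                    ≡⟨ ℤₚ.pos-+ k (length q) ⟨
      + (k ℕ.+ length q)                  ∎))
    where
    open ≡-Reasoning
    rearrange : ∀ h R L → h + (1ℤ + L) + R ≡ h + R + 1ℤ + L
    rearrange = solve-∀

  -- In a returning block of at most k steps, a D can end at height 0 only as the last step.
  noBadPattern-returning : ∀ r h q → suc r ≤ k → length q ≤ k → ReturnsToZero h q →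
    noBadPattern k r h q ≡ not (startsWithURD r (drop (length q ∸ suc r) q))
  noBadPattern-returning zero    h []      _   _    _   = refl
  noBadPattern-returning (suc r) h []      _   _    _   = refl
  noBadPattern-returning r       h (s ∷ q) r<k ∣q∣<k ret with r ℕₚ.<? length q | patternEndsAtZero r h in ends
  ... | yes r<∣q∣ | true  = ⊥-elim (ℕₚ.<-irrefl (patternEndsAtZero⇒length r h s q r<k ∣q∣<k ends ret) r<∣q∣)
  ... | yes r<∣q∣ | false = begin
    not (startsWithURD r (s ∷ q) ∧ false) ∧ noBadPattern k r (h + δ k s) q
      ≡⟨ cong (λ b → not b ∧ noBadPattern k r (h + δ k s) q) (BP.∧-zeroʳ (startsWithURD r (s ∷ q))) ⟩
    noBadPattern k r (h + δ k s) q
      ≡⟨ noBadPattern-returning r (h + δ k s) q r<k (ℕₚ.<⇒≤ ∣q∣<k) (ReturnsToZero-∷ s h q ret) ⟩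
    not (startsWithURD r (drop (length q ∸ suc r) q))
      ≡⟨ cong (λ n → not (startsWithURD r (drop n (s ∷ q)))) (ℕₚ.+-∸-assoc 1 r<∣q∣) ⟨
    not (startsWithURD r (drop (length q ∸ r) (s ∷ q)))
      ∎
    where open ≡-Reasoning
  ... | no r≮∣q∣ | e = begin
    not (startsWithURD r (s ∷ q) ∧ e) ∧ noBadPattern k r (h + δ k s) q
      ≡⟨ cong₂ (λ b c → not b ∧ c) only-at-end rest-clean ⟩
    not (startsWithURD r (s ∷ q)) ∧ true
      ≡⟨ BP.∧-identityʳ _ ⟩
    not (startsWithURD r (s ∷ q))
      ≡⟨ cong (λ n → not (startsWithURD r (drop n (s ∷ q)))) (ℕₚ.m≤n⇒m∸n≡0 ∣q∣≤r) ⟨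
    not (startsWithURD r (drop (length q ∸ r) (s ∷ q)))
      ∎
    where
    open ≡-Reasoning
    ∣q∣≤r : length q ≤ r
    ∣q∣≤r = ℕₚ.≮⇒≥ r≮∣q∣
    rest-clean : noBadPattern k r (h + δ k s) q ≡ true
    rest-clean = trans (noBadPattern-returning r (h + δ k s) q r<k (ℕₚ.<⇒≤ ∣q∣<k) (ReturnsToZero-∷ s h q ret))
      (cong not (trans (cong (λ n → startsWithURD r (drop n q)) (ℕₚ.m≤n⇒m∸n≡0 (ℕₚ.m≤n⇒m≤1+n ∣q∣≤r)))
                       (startsWithURD-short r q ∣q∣≤r)))
    only-at-end : (startsWithURD r (s ∷ q) ∧ e) ≡ startsWithURD r (s ∷ q)
    only-at-end with startsWithURD r (s ∷ q) in p
    ... | false = refl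
    ... | true  = trans (sym ends) (patternEndsAtZero⇐ r h (begin
      h + + r + 1ℤ                  ≡⟨ rearrange h (+ r) ⟩
      h + + suc r                   ≡⟨ cong (λ L → h + + suc L) ∣q∣≡r ⟨
      h + + length (s ∷ q)          ≡⟨ ret ⟩
      + (k ℕ.* downs (s ∷ q))       ≡⟨ cong (λ d → + (k ℕ.* d)) (startsWithURD⇒downs≡1 r (s ∷ q) p (cong suc ∣q∣≡r)) ⟩
      + (k ℕ.* 1)                   ≡⟨ cong +_ (ℕₚ.*-identityʳ k) ⟩
      + k                           ∎))
      where
      ∣q∣≡r : length q ≡ r
      ∣q∣≡r = ℕₚ.≤-antisym ∣q∣≤r (ℕₚ.≤-pred (startsWithURD⇒length r (s ∷ q) p))
      rearrange : ∀ h R → h + R + 1ℤ ≡ h + (1ℤ + R)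
      rearrange = solve-∀

module FinePaths (k a r : ℕ) .{{_ : ℕ.NonZero k}} (a<k : a < k) (r<k : r < k) where
  open Heights k

  -- `isFinePath k a r m` is `fineFrom 0ℤ m` definitionally.
  fineFrom : ℤ → ℕ → List Step → Bool
  fineFrom h m q = ⌊ endHeight k h q ℤ.≟ + (k ℕ.* m) ⌋ ∧ staysAbove k a h q ∧ noBadPattern k r h q

  admissible : List Step → Bool
  admissible p = staysAbove k a 0ℤ p ∧ noBadPattern k r 0ℤ p

  blocks : ℕ → ℕ → ℤ
  blocks m s = ∑paths k (λ q → 𝟙[ fineFrom (+ (k ℕ.* s)) m q ])

  F≡∑paths : ∀ n m → + F k a r n m ≡ ∑paths (k ℕ.* n) (λ p → 𝟙[ isFinePath k a r m p ])
  F≡∑paths n m = count≡∑paths (k ℕ.* n) (isFinePath k a r m)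

  F-upper : ∀ {n m} → n < m → F k a r n m ≡ 0
  F-upper {n} {m} n<m = ℤₚ.+-injective (trans (F≡∑paths n m) (∑paths-zero (k ℕ.* n) not-fine))
    where
    not-fine : ∀ p → length p ≡ k ℕ.* n → 𝟙[ isFinePath k a r m p ] ≡ 0ℤ
    not-fine p ∣p∣ = cong (λ b → 𝟙[ b ∧ admissible p ])
      (⌊⌋-false (endHeight k 0ℤ p ℤ.≟ + (k ℕ.* m)) (ℕₚ.<⇒≱ n<m ∘ endHeight≡k*⇒≤ p ∣p∣))

  Farr≡F : ∀ n m → Farr k a r n m ≡ + F k a r n m
  Farr≡F n m with m ℕ.≤ᵇ n in m≤ᵇn
  ... | true  = refl
  ... | false = cong +_ (sym (F-upper (ℕₚ.≰⇒> (λ m≤n → subst T m≤ᵇn (ℕₚ.≤⇒≤ᵇ m≤n)))))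

  isFinePath-++ : ∀ m n p q → length p ≡ k ℕ.* n →
    isFinePath k a r m (p ++ q) ≡ admissible p ∧ fineFrom (endHeight k 0ℤ p) m q
  isFinePath-++ m n p q ∣p∣ with staysAbove k a 0ℤ p in stays
  ... | false = begin
    ⌊ endHeight k 0ℤ (p ++ q) ℤ.≟ + (k ℕ.* m) ⌋ ∧ staysAbove k a 0ℤ (p ++ q) ∧ _
      ≡⟨ cong (λ b → ⌊ endHeight k 0ℤ (p ++ q) ℤ.≟ + (k ℕ.* m) ⌋ ∧ b ∧ noBadPattern k r 0ℤ (p ++ q))
              (trans (staysAbove-++ a 0ℤ p q) (cong (_∧ staysAbove k a (endHeight k 0ℤ p) q) stays)) ⟩
    ⌊ endHeight k 0ℤ (p ++ q) ℤ.≟ + (k ℕ.* m) ⌋ ∧ false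
      ≡⟨ BP.∧-zeroʳ _ ⟩
    false
      ∎
    where open ≡-Reasoning
  ... | true with staysAbove⇒endHeight≡k* n p a<k ∣p∣ stays
  ...   | s , end≡ , _ = begin
    ⌊ endHeight k 0ℤ (p ++ q) ℤ.≟ + (k ℕ.* m) ⌋ ∧ staysAbove k a 0ℤ (p ++ q) ∧ noBadPattern k r 0ℤ (p ++ q)
      ≡⟨ cong₂ (λ h b → ⌊ h ℤ.≟ + (k ℕ.* m) ⌋ ∧ b ∧ noBadPattern k r 0ℤ (p ++ q))
               (endHeight-++ 0ℤ p q) (trans (staysAbove-++ a 0ℤ p q) (cong (_∧ staysAbove k a e q) stays)) ⟩
    ⌊ endHeight k e q ℤ.≟ + (k ℕ.* m) ⌋ ∧ staysAbove k a e q ∧ noBadPattern k r 0ℤ (p ++ q)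
      ≡⟨ cong (λ b → ⌊ endHeight k e q ℤ.≟ + (k ℕ.* m) ⌋ ∧ staysAbove k a e q ∧ b)
              (noBadPattern-++ r p q 0ℤ r<k (subst (¬_ ∘ InGap) (sym end≡) (¬InGap-k* s))) ⟩
    ⌊ endHeight k e q ℤ.≟ + (k ℕ.* m) ⌋ ∧ staysAbove k a e q ∧ (noBadPattern k r 0ℤ p ∧ noBadPattern k r e q)
      ≡⟨ ∧-pull ⌊ endHeight k e q ℤ.≟ + (k ℕ.* m) ⌋ (staysAbove k a e q) (noBadPattern k r 0ℤ p) (noBadPattern k r e q) ⟩
    noBadPattern k r 0ℤ p ∧ fineFrom e m q
      ∎
    where
    open ≡-Reasoning
    e : ℤ
    e = endHeight k 0ℤ p

  -- An admissible prefix ends at a single height ks₀, which selects the term s₀.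
  𝟙-admissible*blocks : ∀ m n p → length p ≡ k ℕ.* n →
    𝟙[ admissible p ] * ∑paths k (λ q → 𝟙[ fineFrom (endHeight k 0ℤ p) m q ]) ≡
    ∑ (suc n) (λ s → 𝟙[ isFinePath k a r s p ] * blocks m s)
  𝟙-admissible*blocks m n p ∣p∣ with admissible p BP.≟ true
  ... | no ¬adm = begin
    𝟙[ admissible p ] * ∑paths k (λ q → 𝟙[ fineFrom (endHeight k 0ℤ p) m q ])
      ≡⟨ cong (λ b → 𝟙[ b ] * ∑paths k (λ q → 𝟙[ fineFrom (endHeight k 0ℤ p) m q ])) adm≡false ⟩
    0ℤ
      ≡⟨ ∑-zero (suc n) (λ s _ → cong (λ b → 𝟙[ b ] * blocks m s)
           (trans (cong (⌊ endHeight k 0ℤ p ℤ.≟ + (k ℕ.* s) ⌋ ∧_) adm≡false) (BP.∧-zeroʳ _))) ⟨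
    ∑ (suc n) (λ s → 𝟙[ isFinePath k a r s p ] * blocks m s)
      ∎
    where
    open ≡-Reasoning
    adm≡false : admissible p ≡ false
    adm≡false = BP.¬-not ¬adm
  ... | yes adm with staysAbove⇒endHeight≡k* n p a<k ∣p∣ (∧-trueˡ adm)
  ...   | s₀ , end≡ , s₀≤n = begin
    𝟙[ admissible p ] * ∑paths k (λ q → 𝟙[ fineFrom (endHeight k 0ℤ p) m q ])
      ≡⟨ cong (λ b → 𝟙[ b ] * ∑paths k (λ q → 𝟙[ fineFrom (endHeight k 0ℤ p) m q ])) adm ⟩
    1ℤ * ∑paths k (λ q → 𝟙[ fineFrom (endHeight k 0ℤ p) m q ])
      ≡⟨ ℤₚ.*-identityˡ _ ⟩
    ∑paths k (λ q → 𝟙[ fineFrom (endHeight k 0ℤ p) m q ])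
      ≡⟨ cong (λ h → ∑paths k (λ q → 𝟙[ fineFrom h m q ])) end≡ ⟩
    blocks m s₀
      ≡⟨ ℤₚ.*-identityˡ _ ⟨
    𝟙[ true ∧ true ] * blocks m s₀
      ≡⟨ cong₂ (λ b c → 𝟙[ b ∧ c ] * blocks m s₀) (⌊⌋-true (endHeight k 0ℤ p ℤ.≟ + (k ℕ.* s₀)) end≡) adm ⟨
    𝟙[ isFinePath k a r s₀ p ] * blocks m s₀
      ≡⟨ ∑-single (suc n) s₀ (s≤s s₀≤n) other-heights ⟨
    ∑ (suc n) (λ s → 𝟙[ isFinePath k a r s p ] * blocks m s)
      ∎
    where
    open ≡-Reasoning
    other-heights : ∀ s → s < suc n → s ≢ s₀ → 𝟙[ isFinePath k a r s p ] * blocks m s ≡ 0ℤ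
    other-heights s _ s≢s₀ = cong (λ b → 𝟙[ b ∧ admissible p ] * blocks m s)
      (⌊⌋-false (endHeight k 0ℤ p ℤ.≟ + (k ℕ.* s))
                (λ end≡′ → s≢s₀ (ℕₚ.*-cancelˡ-≡ s s₀ k (ℤₚ.+-injective (trans (sym end≡′) end≡)))))

  F-suc : ∀ n m → + F k a r (suc n) m ≡ ∑ (suc n) (λ s → + F k a r n s * blocks m s)
  F-suc n m = begin
    + F k a r (suc n) m
      ≡⟨ F≡∑paths (suc n) m ⟩
    ∑paths (k ℕ.* suc n) fine
      ≡⟨ cong (λ L → ∑paths L fine) (trans (ℕₚ.*-suc k n) (ℕₚ.+-comm k (k ℕ.* n))) ⟩
    ∑paths (k ℕ.* n ℕ.+ k) fine
      ≡⟨ ∑paths-++ (k ℕ.* n) k fine ⟩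
    ∑paths (k ℕ.* n) (λ p → ∑paths k (λ q → fine (p ++ q)))
      ≡⟨ ∑paths-cong (k ℕ.* n) split-prefix ⟩
    ∑paths (k ℕ.* n) (λ p → 𝟙[ admissible p ] * ∑paths k (λ q → 𝟙[ fineFrom (endHeight k 0ℤ p) m q ]))
      ≡⟨ ∑paths-cong (k ℕ.* n) (𝟙-admissible*blocks m n) ⟩
    ∑paths (k ℕ.* n) (λ p → ∑ (suc n) (λ s → 𝟙[ isFinePath k a r s p ] * blocks m s))
      ≡⟨ ∑paths-∑ (k ℕ.* n) (suc n) (λ p s → 𝟙[ isFinePath k a r s p ] * blocks m s) ⟩
    ∑ (suc n) (λ s → ∑paths (k ℕ.* n) (λ p → 𝟙[ isFinePath k a r s p ] * blocks m s))
      ≡⟨ ∑-cong (suc n) (λ s _ → count-times s) ⟩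
    ∑ (suc n) (λ s → + F k a r n s * blocks m s)
      ∎
    where
    open ≡-Reasoning
    fine : List Step → ℤ
    fine p = 𝟙[ isFinePath k a r m p ]
    split-prefix : ∀ p → length p ≡ k ℕ.* n → ∑paths k (λ q → fine (p ++ q)) ≡
                   𝟙[ admissible p ] * ∑paths k (λ q → 𝟙[ fineFrom (endHeight k 0ℤ p) m q ])
    split-prefix p ∣p∣ =
      trans (∑paths-cong k (λ q _ → trans (cong 𝟙[_] (isFinePath-++ m n p q ∣p∣))
                                          (𝟙-∧ (admissible p) (fineFrom (endHeight k 0ℤ p) m q))))
            (∑paths-*ˡ k 𝟙[ admissible p ] (λ q → 𝟙[ fineFrom (endHeight k 0ℤ p) m q ]))
    count-times : ∀ s → ∑paths (k ℕ.* n) (λ p → 𝟙[ isFinePath k a r s p ] * blocks m s) ≡ + F k a r n s * blocks m s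
    count-times s = begin
      ∑paths (k ℕ.* n) (λ p → 𝟙[ isFinePath k a r s p ] * blocks m s)
        ≡⟨ ∑paths-cong (k ℕ.* n) (λ p _ → ℤₚ.*-comm _ (blocks m s)) ⟩
      ∑paths (k ℕ.* n) (λ p → blocks m s * 𝟙[ isFinePath k a r s p ])
        ≡⟨ ∑paths-*ˡ (k ℕ.* n) (blocks m s) _ ⟩
      blocks m s * ∑paths (k ℕ.* n) (λ p → 𝟙[ isFinePath k a r s p ])
        ≡⟨ cong (blocks m s *_) (F≡∑paths n s) ⟨
      blocks m s * + F k a r n s
        ≡⟨ ℤₚ.*-comm (blocks m s) _ ⟩
      + F k a r n s * blocks m s
        ∎

  blocks-A : ∀ j s → blocks (suc j) (j ℕ.+ s) ≡ Aseq k s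
  blocks-A j s = trans (∑paths-cong k high) (∑paths-downs≡binomial k s)
    where
    e : ℤ
    e = + (k ℕ.* (j ℕ.+ s))
    high : ∀ q → length q ≡ k → 𝟙[ fineFrom e (suc j) q ] ≡ 𝟙[ downs q ℕ.≡ᵇ s ]
    high q ∣q∣ = cong 𝟙[_] (begin
      fineFrom e (suc j) q                            ≡⟨ ∧-redundantʳ ⌊ endHeight k e q ℤ.≟ + (k ℕ.* suc j) ⌋ _ unconstrained ⟩
      ⌊ endHeight k e q ℤ.≟ + (k ℕ.* suc j) ⌋         ≡⟨ ⌊endHeight≟⌋-block (j ℕ.+ s) (suc j) q ∣q∣ ⟩
      (suc j ℕ.+ downs q ℕ.≡ᵇ suc j ℕ.+ s)            ≡⟨ ≡ᵇ-cancelˡ (suc j) (downs q) s ⟩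
      (downs q ℕ.≡ᵇ s)                                ∎)
      where
      open ≡-Reasoning
      unconstrained : ⌊ endHeight k e q ℤ.≟ + (k ℕ.* suc j) ⌋ ≡ true → (staysAbove k a e q ∧ noBadPattern k r e q) ≡ true
      unconstrained ends = cong₂ _∧_ (AllPositive⇒staysAbove a e q positive) (AllPositive⇒noBadPattern r e q positive)
        where
        end≡ : endHeight k e q ≡ + (k ℕ.* suc j)
        end≡ = ⌊⌋-sound (endHeight k e q ℤ.≟ + (k ℕ.* suc j)) ends
        positive : AllPositive e q
        positive = endHeight≥k⇒AllPositive e q (ℕₚ.≤-reflexive ∣q∣)
                     (subst (+ k ℤ.≤_) (sym end≡) (+≤+ (ℕₚ.m≤m*n k (suc j))))

  blocks-below : ∀ j s → s < j → blocks (suc j) s ≡ 0ℤ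
  blocks-below j s s<j = ∑paths-zero k (λ q ∣q∣ →
    cong (λ b → 𝟙[ b ∧ staysAbove k a (+ (k ℕ.* s)) q ∧ noBadPattern k r (+ (k ℕ.* s)) q ])
         (trans (⌊endHeight≟⌋-block s (suc j) q ∣q∣)
                (≡ᵇ-false (λ eq → ℕₚ.<⇒≱ s<j (subst (j ≤_) (ℕₚ.suc-injective eq) (ℕₚ.m≤m+n j (downs q)))))))

  fineFrom-returning : ∀ s q → length q ≡ k →
    fineFrom (+ (k ℕ.* s)) 0 q ≡
    (downs q ℕ.≡ᵇ suc s) ∧ not (allUp (drop (k ∸ suc a) q)) ∧ not (startsWithURD r (drop (k ∸ suc r) q))
  fineFrom-returning s q ∣q∣ with downs q ℕ.≡ᵇ suc s in downs≡ᵇ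
  ... | false = cong (_∧ staysAbove k a e q ∧ noBadPattern k r e q)
                     (trans (⌊endHeight≟⌋-block s 0 q ∣q∣) downs≡ᵇ)
    where
    e : ℤ
    e = + (k ℕ.* s)
  ... | true  = cong₂ _∧_ (trans (⌊endHeight≟⌋-block s 0 q ∣q∣) downs≡ᵇ)
      (cong₂ _∧_ (trans (staysAbove-returning a e q (ℕₚ.≤-reflexive ∣q∣) (subst (1 ≤_) (sym downs≡) (s≤s z≤n)) returns)
                        (cong (λ L → not (allUp (drop (L ∸ suc a) q))) ∣q∣))
                 (trans (noBadPattern-returning r e q r<k (ℕₚ.≤-reflexive ∣q∣) returns)
                        (cong (λ L → not (startsWithURD r (drop (L ∸ suc r) q))) ∣q∣)))
    where
    e : ℤ
    e = + (k ℕ.* s)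
    downs≡ : downs q ≡ suc s
    downs≡ = ℕₚ.≡ᵇ⇒≡ (downs q) (suc s) (subst T (sym downs≡ᵇ) _)
    returns : ReturnsToZero e q
    returns = begin
      + (k ℕ.* s) + + length q     ≡⟨ ℤₚ.pos-+ (k ℕ.* s) (length q) ⟨
      + (k ℕ.* s ℕ.+ length q)     ≡⟨ cong (λ L → + (k ℕ.* s ℕ.+ L)) ∣q∣ ⟩
      + (k ℕ.* s ℕ.+ k)            ≡⟨ cong +_ (trans (ℕₚ.+-comm (k ℕ.* s) k) (sym (ℕₚ.*-suc k s))) ⟩
      + (k ℕ.* suc s)              ≡⟨ cong (λ d → + (k ℕ.* d)) downs≡ ⟨
      + (k ℕ.* downs q)            ∎
      where open ≡-Reasoning

  -- Ending with U^{a+1} and ending with U^r D are exclusive: they disagree on the last step.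
  ¬allUp-suffix×URD-suffix : ∀ q → allUp (drop (k ∸ suc a) q) ≡ true →
    startsWithURD r (drop (k ∸ suc r) q) ≡ true → ⊥
  ¬allUp-suffix×URD-suffix q up urd = BP.not-¬ refl (trans (sym last-up) last-down)
    where
    last-up : allUp (drop (k ∸ 1) q) ≡ true
    last-up = subst (λ n → allUp (drop n q) ≡ true) (∸-suc-+ k a<k)
                (subst (λ l → allUp l ≡ true) (Listₚ.drop-drop (k ∸ suc a) a q) (allUp-drop a _ up))
    last-down : allUp (drop (k ∸ 1) q) ≡ false
    last-down = subst (λ n → allUp (drop n q) ≡ false) (∸-suc-+ k r<k)
                  (subst (λ l → allUp l ≡ false) (Listₚ.drop-drop (k ∸ suc r) r q) (startsWithURD⇒¬allUp-drop r _ urd))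

  blocks-Z : ∀ s → blocks 0 s ≡ Zseq k a r s
  blocks-Z s = begin
    blocks 0 s                                                    ≡⟨ isolate (blocks 0 s) ΣX ΣY ΣT partition ⟩
    ΣT - ΣX - ΣY                                                  ≡⟨ cong₂ (λ x y → ΣT - x - y) ΣX≡ ΣY≡ ⟩
    ΣT - (onePlusT ^S (k ∸ suc a)) (suc s) - (onePlusT ^S (k ∸ suc r)) s
      ≡⟨ cong₂ (λ x y → ΣT - (onePlusT ^S x) (suc s) - (onePlusT ^S y) s) (∸-∸-1 a) (∸-∸-1 r) ⟨
    ΣT - (onePlusT ^S (k ∸ a ∸ 1)) (suc s) - (onePlusT ^S (k ∸ r ∸ 1)) s
      ≡⟨ cong (λ x → x - (onePlusT ^S (k ∸ a ∸ 1)) (suc s) - (onePlusT ^S (k ∸ r ∸ 1)) s) (∑paths-downs≡binomial k (suc s)) ⟩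
    Zseq k a r s                                                  ∎
    where
    open ≡-Reasoning
    ending-U^a+1 ending-U^rD : List Step → Bool
    ending-U^a+1 q = allUp (drop (k ∸ suc a) q)
    ending-U^rD  q = startsWithURD r (drop (k ∸ suc r) q)
    fine x y total : List Step → ℤ
    fine  q = 𝟙[ fineFrom (+ (k ℕ.* s)) 0 q ]
    x     q = 𝟙[ (downs q ℕ.≡ᵇ suc s) ∧ ending-U^a+1 q ]
    y     q = 𝟙[ (downs q ℕ.≡ᵇ suc s) ∧ ending-U^rD q ]
    total q = 𝟙[ downs q ℕ.≡ᵇ suc s ]
    ΣX ΣY ΣT : ℤ
    ΣX = ∑paths k x
    ΣY = ∑paths k y
    ΣT = ∑paths k total
    ΣX≡ : ΣX ≡ (onePlusT ^S (k ∸ suc a)) (suc s)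
    ΣX≡ = ∑paths-suffix k (suc a) 0 (suc s) allUp a<k (∑paths-allUp (suc a))
    ΣY≡ : ΣY ≡ (onePlusT ^S (k ∸ suc r)) s
    ΣY≡ = ∑paths-suffix k (suc r) 1 s (startsWithURD r) r<k (∑paths-URD r)
    ∸-∸-1 : ∀ x → k ∸ x ∸ 1 ≡ k ∸ suc x
    ∸-∸-1 x = trans (ℕₚ.∸-+-assoc k x 1) (cong (k ∸_) (ℕₚ.+-comm x 1))
    partition : blocks 0 s + ΣX + ΣY ≡ ΣT
    partition = trans (cong (_+ ΣY) (sym (∑paths-+ k fine x)))
                  (trans (sym (∑paths-+ k (λ q → fine q + x q) y))
                    (∑paths-cong k (λ q ∣q∣ → trans (cong (λ b → 𝟙[ b ] + x q + y q) (fineFrom-returning s q ∣q∣))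
                      (𝟙-partition (downs q ℕ.≡ᵇ suc s) (ending-U^a+1 q) (ending-U^rD q) (¬allUp-suffix×URD-suffix q)))))
    isolate : ∀ v x y t → v + x + y ≡ t → v ≡ t - x - y
    isolate v x y t eq = trans (cancel v x y) (cong (λ w → w - x - y) eq)
      where
      cancel : ∀ v x y → v ≡ v + x + y - x - y
      cancel = solve-∀

  hasASeq : HasASeq (Farr k a r) (Aseq k)
  hasASeq i j = begin
    Farr k a r (suc i) (suc j)
      ≡⟨ trans (Farr≡F (suc i) (suc j)) (F-suc i (suc j)) ⟩
    ∑ (suc i) (λ s → + F k a r i s * blocks (suc j) s)
      ≡⟨ ∑-shift (suc i) j (λ s s<j → trans (cong (+ F k a r i s *_) (blocks-below j s s<j)) (ℤₚ.*-zeroʳ (+ F k a r i s)))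
                           (λ s i<s → cong (λ n → + n * blocks (suc j) s) (F-upper i<s)) ⟩
    ∑ (suc i) (λ s → + F k a r i (j ℕ.+ s) * blocks (suc j) (j ℕ.+ s))
      ≡⟨ ∑-cong (suc i) (λ s _ → term s) ⟩
    ∑ (suc i) (λ s → Aseq k s * Farr k a r i (j ℕ.+ s))
      ≡⟨ sumTo≡∑ (suc i) (λ s → Aseq k s * Farr k a r i (j ℕ.+ s)) ⟨
    sumTo (suc i) (λ s → Aseq k s * Farr k a r i (j ℕ.+ s))
      ∎
    where
    open ≡-Reasoning
    term : ∀ s → + F k a r i (j ℕ.+ s) * blocks (suc j) (j ℕ.+ s) ≡ Aseq k s * Farr k a r i (j ℕ.+ s)
    term s = trans (cong₂ _*_ (sym (Farr≡F i (j ℕ.+ s))) (blocks-A j s)) (ℤₚ.*-comm (Farr k a r i (j ℕ.+ s)) (Aseq k s))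

  hasZSeq : HasZSeq (Farr k a r) (Zseq k a r)
  hasZSeq i = begin
    Farr k a r (suc i) 0
      ≡⟨ trans (Farr≡F (suc i) 0) (F-suc i 0) ⟩
    ∑ (suc i) (λ s → + F k a r i s * blocks 0 s)
      ≡⟨ ∑-cong (suc i) (λ s _ → term s) ⟩
    ∑ (suc i) (λ s → Zseq k a r s * Farr k a r i s)
      ≡⟨ sumTo≡∑ (suc i) (λ s → Zseq k a r s * Farr k a r i s) ⟨
    sumTo (suc i) (λ s → Zseq k a r s * Farr k a r i s)
      ∎
    where
    open ≡-Reasoning
    term : ∀ s → + F k a r i s * blocks 0 s ≡ Zseq k a r s * Farr k a r i s
    term s = trans (cong₂ _*_ (sym (Farr≡F i s)) (blocks-Z s)) (ℤₚ.*-comm (Farr k a r i s) (Zseq k a r s))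

  Farr₀₀≡1 : Farr k a r 0 0 ≡ 1ℤ
  Farr₀₀≡1 = trans (F≡∑paths 0 0)
    (trans (cong (λ L → ∑paths L (λ p → 𝟙[ isFinePath k a r 0 p ])) (ℕₚ.*-zeroʳ k))
           (cong (λ b → 𝟙[ b ∧ true ∧ true ]) (⌊⌋-true (0ℤ ℤ.≟ + (k ℕ.* 0)) (cong +_ (sym (ℕₚ.*-zeroʳ k))))))

  isProperRiordan : IsProperRiordan (Farr k a r)
  isProperRiordan = ASeq⇒IsProperRiordan (Aseq k) (Farr k a r)
    (λ F₀₀≡0 → 1ℤ≢0ℤ (trans (sym Farr₀₀≡1) F₀₀≡0))
    (λ A₀≡0 → 1ℤ≢0ℤ (trans (sym (onePlusT^-zero k)) A₀≡0))
    (λ _ → refl) hasASeq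

theorem3p5 : (k a r : ℕ) → 2 ≤ k → a ≤ k Data.Nat.∸ 1 → 1 ≤ r → r ≤ k Data.Nat.∸ 1 →
    IsProperRiordan (Farr k a r) × HasASeq (Farr k a r) (Aseq k) × HasZSeq (Farr k a r) (Zseq k a r)
theorem3p5 (suc k) a r _ a≤k _ r≤k = isProperRiordan , hasASeq , hasZSeq
  where open FinePaths (suc k) a r (s≤s a≤k) (s≤s r≤k)
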